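{- Let $m\ge 3$ and $n\ge 2$ be integers with $m\ne 2n-1$. Then the squid graph $\mathrm{Sq}(m;1^n)$ is not Schur positive.
   Context: $\mathrm{Sq}(m;1^n)$ is the graph obtained from a cycle on $m$ vertices by attaching $n$ new pendant vertices (leaves), each adjacent only to one common fixed vertex $v_0$ of the cycle. The chromatic symmetric function of a graph $G$ is $X_G=\sum_{\kappa}\prod_{v\in V(G)}x_{\kappa(v)}$, summed over all proper colorings $\kappa:V(G)\to\{1,2,\dots\}$; $G$ is Schur positive if all coefficients of $X_G$ in the Schur basis are nonnegative. -}

module Defs where

open import Data.Nat using (ℕ; zero; suc; _+_; _*_; _∸_; _≡ᵇ_; _<ᵇ_; _≤ᵇ_)
open import Data.Fin using (Fin; toℕ)
open import Data.Bool using (Bool; true; false; _∧_; _∨_; not; if_then_else_)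
open import Data.List using (List; []; _∷_; [_]; map; concatMap; filter; length)
open import Data.Nat.ListAction using (sum)
open import Data.List using () renaming (allFin to finList)
open import Data.Vec.Functional using (Vector) renaming (_∷_ to _∷ᶠ_)
open import Data.Product using (Σ; _×_)
open import Relation.Binary.PropositionalEquality using (_≡_)
open import Relation.Nullary using (¬_)
open import Data.Bool using (T)

funs : {B : Set} (a : ℕ) → List B → List (Fin a → B)
funs zero    bs = [ (λ ()) ]
funs (suc a) bs = concatMap (λ b → map (λ f → b ∷ᶠ f) (funs a bs)) bs

count : {A : Set} → List A → (A → Bool) → ℕ
count xs p = length (filter (λ x → T? (p x)) xs)
  where
  open import Data.Bool using (T?)

allB : {A : Set} → List A → (A → Bool) → Bool
allB []       p = true
allB (x ∷ xs) p = p x ∧ allB xs p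

record Graph : Set where
  field
    V   : ℕ
    adj : Fin V → Fin V → Bool
open Graph public

-- The squid graph Sq(m;1^n): vertices 0..m-1 form the cycle
-- 0 - 1 - ... - (m-1) - 0, vertices m..m+n-1 are leaves attached to v₀ = 0.
cycAdj : ℕ → ℕ → ℕ → Bool
cycAdj m a b = (suc a ≡ᵇ b) ∨ (suc b ≡ᵇ a)
             ∨ ((a ≡ᵇ 0) ∧ (b ≡ᵇ (m ∸ 1)))
             ∨ ((b ≡ᵇ 0) ∧ (a ≡ᵇ (m ∸ 1)))

squidAdj : (m n : ℕ) → Fin (m + n) → Fin (m + n) → Bool
squidAdj m n i j with toℕ i <ᵇ m | toℕ j <ᵇ m
... | true  | true  = cycAdj m (toℕ i) (toℕ j)
... | true  | false = toℕ i ≡ᵇ 0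
... | false | true  = toℕ j ≡ᵇ 0
... | false | false = false

Squid : ℕ → ℕ → Graph
Squid m n = record { V = m + n ; adj = squidAdj m n }

-- Chromatic symmetric function, restricted to N = |V(G)| variables
-- x₀,…,x_{N-1}. A monomial x^α is given by its exponent vector α : Fin N → ℕ.

_=ᶠ_ : {k : ℕ} → Fin k → Fin k → Bool
i =ᶠ j = toℕ i ≡ᵇ toℕ j

isProper : (G : Graph) → (Fin (V G) → Fin (V G)) → Bool
isProper G κ = allB (finList (V G)) λ i → allB (finList (V G)) λ j →
                 not (adj G i j) ∨ not (κ i =ᶠ κ j)

colContent : (G : Graph) → (Fin (V G) → Fin (V G)) → (Fin (V G) → ℕ) → Bool
colContent G κ α = allB (finList (V G)) λ k →
                     count (finList (V G)) (λ v → κ v =ᶠ k) ≡ᵇ α k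

chromCoeff : (G : Graph) → (Fin (V G) → ℕ) → ℕ
chromCoeff G α = count (funs (V G) (finList (V G)))
                       (λ κ → isProper G κ ∧ colContent G κ α)

-- Partitions of N, as weakly decreasing λ : Fin N → {0..N} with sum N
-- (every partition of N has at most N parts; trailing zeros pad).

sumF : {k : ℕ} → (Fin k → ℕ) → ℕ
sumF {k} f = sum (map f (finList k))

isPartition : (N : ℕ) → (Fin N → Fin (suc N)) → Bool
isPartition N λp =
  (sumF (λ r → toℕ (λp r)) ≡ᵇ N) ∧
  allB (finList N) (λ i → allB (finList N) (λ j →
     not (toℕ i <ᵇ toℕ j) ∨ (toℕ (λp j) ≤ᵇ toℕ (λp i))))

partitions : (N : ℕ) → List (Fin N → Fin (suc N))
partitions N = filter (λ l → Data.Bool.T? (isPartition N l)) (funs N (finList (suc N)))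
  where import Data.Bool

-- A filling T r c (row r, column c) with entries in Fin N; cells outside
-- the Young diagram of λ are required to hold 0 (so they are not counted twice).

inShape : {N : ℕ} → (Fin N → Fin (suc N)) → Fin N → Fin N → Bool
inShape λp r c = toℕ c <ᵇ toℕ (λp r)

isSSYT : (N : ℕ) → (Fin N → Fin (suc N)) → (Fin N → Fin N → Fin N) → Bool
isSSYT N λp Tb =
  allB (finList N) λ r → allB (finList N) λ c →
    (inShape λp r c ∨ (toℕ (Tb r c) ≡ᵇ 0)) ∧
    allB (finList N) (λ c' →
      not (inShape λp r c ∧ inShape λp r c' ∧ (toℕ c <ᵇ toℕ c'))
      ∨ (toℕ (Tb r c) ≤ᵇ toℕ (Tb r c'))) ∧
    allB (finList N) (λ r' →
      not (inShape λp r c ∧ inShape λp r' c ∧ (toℕ r <ᵇ toℕ r'))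
      ∨ (toℕ (Tb r c) <ᵇ toℕ (Tb r' c)))

tabContent : (N : ℕ) → (Fin N → Fin (suc N)) → (Fin N → Fin N → Fin N) → (Fin N → ℕ) → Bool
tabContent N λp Tb α = allB (finList N) λ k →
  sumF (λ r → count (finList N) (λ c → inShape λp r c ∧ (Tb r c =ᶠ k))) ≡ᵇ α k

schurCoeff : (N : ℕ) → (Fin N → Fin (suc N)) → (Fin N → ℕ) → ℕ
schurCoeff N λp α = count (funs N (funs N (finList N)))
                          (λ Tb → isSSYT N λp Tb ∧ tabContent N λp Tb α)

-- Schur positivity: X_G = Σ_λ c_λ s_λ with all c_λ ≥ 0.  X_G is homogeneous
-- of degree N = |V(G)|, and Λ^N → Λ^N(x₀,…,x_{N-1}) is an isomorphism, so
-- it suffices to compare coefficients of all monomials in N variables.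
-- (Schur coefficients of X_G are integers, so nonnegative ones are naturals.)

SchurPositive : Graph → Set
SchurPositive G =
  Σ ((Fin (V G) → Fin (suc (V G))) → ℕ) λ c →
    (α : Fin (V G) → ℕ) →
      chromCoeff G α ≡ sum (map (λ l → c l * schurCoeff (V G) l α) (partitions (V G)))

-- Let w₁ < w₀ and let w′ arise from w by moving one unit of weight from part 0 to part 1.
-- Turning the rightmost 0 of the first row of a semistandard tableau of content w into a 1
-- gives a semistandard tableau of content w′: the entry below it is at least 2, since
-- otherwise the second row would contain at least w₀ > w₁ ones. This map is injective, so
-- K_{λ,w} ≤ K_{λ,w′} for every λ, and a Schur positive X_G has [x^w] X_G ≤ [x^w′] X_G.
--
-- In Sq(m;1^n) the colour class of the root v₀ contains no leaf and neither cycle neighbour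
-- of v₀, so it has at most m/2 vertices. Let K = ⌊m/2⌋.
--  * m = 2K: w = (n+K, K) is realised by alternating 1, 0 around the cycle and colouring
--    the leaves 0, while every part of w′ = (n+K-1, K+1) exceeds K, so [x^w′] X_G = 0.
--  * m = 2K+1, n ≥ K+2: the same with w = (n, K, K+1) and w′ = (n-1, K+1, K+1).
--  * m = 2K+1, n ≤ K: for w = (n+K, K, 1), putting the colour 2 on any one of the 2K+1 cycle
--    vertices gives 2K+1 colourings. A colouring of content w′ = (n+K-1, K+1, 1) must give v₀
--    the colour 2, alternate on the rest of the cycle and colour exactly one leaf 1, so there
--    are at most 2n ≤ 2K of them.
-- The only remaining odd case, n = K+1, is m = 2n-1.

module Submission where

open import Data.Bool.Base using (Bool; true; false; not; _∧_; _∨_; T)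
open import Data.Bool.Properties using (T-∧; T-∨; T-≡)
open import Data.Empty using (⊥; ⊥-elim)
open import Data.Fin.Base using (Fin; zero; suc; toℕ; inject₁)
open import Data.Fin.Properties using (toℕ-fromℕ<; toℕ-injective; toℕ<n; toℕ-inject₁)
  renaming (_≟_ to _≟ᶠ_)
open import Data.List.Base using (List; []; _∷_; _++_; map; filter; length; tabulate; allFin; applyUpTo)
open import Data.List.Properties using (length-removeAt′; length-map; map-cong; map-tabulate; length-applyUpTo; length-++)
open import Data.List.Membership.Propositional.Properties using (∈-allFin)
import Data.List.Membership.Setoid as MembershipS
import Data.List.Membership.Setoid.Properties as MembershipSₚ
open import Data.List.Relation.Unary.All using (All; []; _∷_)
import Data.List.Relation.Unary.All as All
import Data.List.Relation.Unary.All.Properties as Allₚ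
open import Data.List.Relation.Unary.AllPairs using (AllPairs; []; _∷_)
import Data.List.Relation.Unary.AllPairs as AllPairs
import Data.List.Relation.Unary.AllPairs.Properties as AllPairsₚ
open import Data.List.Relation.Unary.Any using (Any; here; there; _─_)
import Data.List.Relation.Unary.Any as Any
import Data.List.Relation.Unary.Any.Properties as Anyₚ
open import Data.List.Relation.Unary.Unique.Propositional.Properties using (allFin⁺)
import Data.List.Relation.Unary.Unique.Setoid as UniqueS
import Data.List.Relation.Unary.Unique.Setoid.Properties as UniqueSₚ
open import Data.Nat.Base
  using (ℕ; NonZero; >-nonZero; zero; suc; pred; _+_; _*_; _∸_; _≤_; _<_; z≤n; s≤s; z<s; s<s; s≤s⁻¹; s<s⁻¹; _<ᵇ_; _≤ᵇ_; _≡ᵇ_)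
open import Data.Nat.DivMod using (_mod_; m%n<n; m<n⇒m%n≡m)
open import Data.Nat.ListAction using (sum)
open import Data.Nat.Properties
open import Data.Product.Base using (∃-syntax; _×_; _,_; proj₁; proj₂; uncurry)
open import Data.Sum.Base using (_⊎_; inj₁; inj₂; [_,_]′)
import Data.Sum.Base as Sum
open import Data.Vec.Functional using (Vector) renaming (_∷_ to _∷ᶠ_)
import Data.Vec.Functional.Relation.Binary.Equality.Setoid as VecEq
open import Function.Base using (_∘_; id)
open import Function.Bundles using (_⇔_; mk⇔; Equivalence)
open import Level using (0ℓ)
open import Relation.Binary.Bundles using (Setoid)
open import Relation.Binary.Definitions using (_Respects_; tri<; tri≈; tri>)
open import Relation.Binary.PropositionalEquality
open import Relation.Nullary.Decidable using (T?; yes; no)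
open import Relation.Nullary.Negation using (¬_; contradiction)

open import Defs

fromBool : Bool → ℕ
fromBool true  = 1
fromBool false = 0

fromBool≤1 : ∀ b → fromBool b ≤ 1
fromBool≤1 true  = ≤-refl
fromBool≤1 false = z≤n

¬T⇒≡false : ∀ {b} → ¬ T b → b ≡ false
¬T⇒≡false {false} _  = refl
¬T⇒≡false {true}  ¬t = contradiction _ ¬t

T-not⇒¬T : ∀ {b} → T (not b) → ¬ T b
T-not⇒¬T {false} _ ()

¬T⇒T-not : ∀ {b} → ¬ T b → T (not b)
¬T⇒T-not {false} _  = _
¬T⇒T-not {true}  ¬t = ¬t _

T-⇒ : ∀ {a b} → T (not a ∨ b) → T a → T b
T-⇒ {true} Tb _ = Tb

T-⇒⁺ : ∀ {a b} → (T a → T b) → T (not a ∨ b)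
T-⇒⁺ {true}  f = f _
T-⇒⁺ {false} _ = _

T-∧³ : ∀ {a b c} → T a → T b → T c → T (a ∧ b ∧ c)
T-∧³ {true} {true} {true} _ _ _ = _

T-∧³⁻ : ∀ {a b c} → T (a ∧ b ∧ c) → T a × T b × T c
T-∧³⁻ {true} {true} {true} _ = _ , _ , _

T-∧⁻ʳ : ∀ {a b} → T (a ∧ b) → T b
T-∧⁻ʳ {a} = proj₂ ∘ Equivalence.to (T-∧ {a})

countBelow : (ℕ → Bool) → ℕ → ℕ
countBelow P zero    = 0
countBelow P (suc L) = fromBool (P 0) + countBelow (P ∘ suc) L

countBelow-+ : ∀ P a b → countBelow P (a + b) ≡ countBelow P a + countBelow (λ i → P (a + i)) b
countBelow-+ P zero    b = refl
countBelow-+ P (suc a) b =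
  trans (cong (fromBool (P 0) +_) (countBelow-+ (P ∘ suc) a b)) (sym (+-assoc (fromBool (P 0)) _ _))

countBelow-suc : ∀ P L → countBelow P (suc L) ≡ countBelow P L + fromBool (P L)
countBelow-suc P zero    = +-identityʳ _
countBelow-suc P (suc L) =
  trans (cong (fromBool (P 0) +_) (countBelow-suc (P ∘ suc) L)) (sym (+-assoc (fromBool (P 0)) _ _))

countBelow-cong : ∀ {P Q} L → (∀ {i} → i < L → P i ≡ Q i) → countBelow P L ≡ countBelow Q L
countBelow-cong zero    _   = refl
countBelow-cong (suc L) P≡Q = cong₂ _+_ (cong fromBool (P≡Q z<s)) (countBelow-cong L (P≡Q ∘ s<s))

countBelow≤ : ∀ P L → countBelow P L ≤ L
countBelow≤ P zero    = z≤n
countBelow≤ P (suc L) = +-mono-≤ (fromBool≤1 (P 0)) (countBelow≤ (P ∘ suc) L)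

countBelow-none : ∀ {P} L → (∀ {i} → i < L → ¬ T (P i)) → countBelow P L ≡ 0
countBelow-none {P} zero    _  = refl
countBelow-none {P} (suc L) ¬P with P 0 | ¬P {0} z<s
... | true  | ¬P0 = contradiction _ ¬P0
... | false | _   = countBelow-none L (¬P ∘ s<s)

countBelow-all : ∀ {P} L → (∀ {i} → i < L → T (P i)) → countBelow P L ≡ L
countBelow-all {P} zero    _  = refl
countBelow-all {P} (suc L) allP with P 0 | allP {0} z<s
... | true | _ = cong suc (countBelow-all L (allP ∘ s<s))

countBelow-pos : ∀ P {L i} → i < L → T (P i) → 0 < countBelow P L
countBelow-pos P {suc L} {zero} _ Pi with P 0
... | true = z<s
countBelow-pos P {suc L} {suc i} (s<s i<L) Pi =
  ≤-trans (countBelow-pos (P ∘ suc) i<L Pi) (m≤n+m _ (fromBool (P 0)))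

countBelow-≥ : ∀ {P} a L → a ≤ L → (∀ {i} → i < a → T (P i)) → a ≤ countBelow P L
countBelow-≥ {P} zero    L       _         _  = z≤n
countBelow-≥ {P} (suc a) (suc L) (s≤s a≤L) Pi with P 0 | Pi {0} z<s
... | true | _ = s≤s (countBelow-≥ a L a≤L (Pi ∘ s<s))

countBelow≡0⇒ : ∀ P {L i} → countBelow P L ≡ 0 → i < L → ¬ T (P i)
countBelow≡0⇒ P #P≡0 i<L Pi = <-irrefl (sym #P≡0) (countBelow-pos P i<L Pi)

countBelow≡1⇒ : ∀ P L → countBelow P L ≡ 1 →
                ∃[ i ] (i < L × T (P i) × ∀ {j} → j < L → T (P j) → j ≡ i)
countBelow≡1⇒ P (suc L) #P≡1 with P 0 in P0
... | true  = 0 , z<s , subst T (sym P0) _ , unique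
  where
  unique : ∀ {j} → j < suc L → T (P j) → j ≡ 0
  unique {zero}  _         _  = refl
  unique {suc j} (s<s j<L) Pj = contradiction Pj (countBelow≡0⇒ (P ∘ suc) (suc-injective #P≡1) j<L)
... | false with countBelow≡1⇒ (P ∘ suc) L #P≡1
...   | i , i<L , Pi , unique = suc i , s<s i<L , Pi , unique′
  where
  unique′ : ∀ {j} → j < suc L → T (P j) → j ≡ suc i
  unique′ {zero}  _         Pj = contradiction (subst T P0 Pj) id
  unique′ {suc j} (s<s j<L) Pj = cong suc (unique j<L Pj)

countBelow-update : ∀ P Q L {i₀} → i₀ < L → (∀ {i} → i < L → i ≢ i₀ → P i ≡ Q i) →
                    countBelow P L + fromBool (Q i₀) ≡ countBelow Q L + fromBool (P i₀)
countBelow-update P Q (suc L) {zero} _ P≡Q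
  rewrite countBelow-cong {P ∘ suc} {Q ∘ suc} L (λ i<L → P≡Q (s<s i<L) λ ())
  = swap-outer (fromBool (P 0)) (countBelow (Q ∘ suc) L) (fromBool (Q 0))
  where
  swap-outer : ∀ a b c → a + b + c ≡ c + b + a
  swap-outer a b c = trans (+-assoc a b c) (trans (+-comm a (b + c)) (cong (_+ a) (+-comm b c)))
countBelow-update P Q (suc L) {suc i₀} (s<s i₀<L) P≡Q
  rewrite P≡Q z<s (λ ())
  = trans (+-assoc (fromBool (Q 0)) _ _)
      (trans (cong (fromBool (Q 0) +_)
               (countBelow-update (P ∘ suc) (Q ∘ suc) L i₀<L
                  (λ i<L i≢i₀ → P≡Q (s<s i<L) (i≢i₀ ∘ suc-injective))))
             (sym (+-assoc (fromBool (Q 0)) _ _)))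

countBelow-downClosed : ∀ P L → (∀ {i j} → i ≤ j → j < L → T (P j) → T (P i)) →
                        ∀ {i} → i < L → P i ≡ (i <ᵇ countBelow P L)
countBelow-downClosed P (suc L) closed {i} i<L with P 0 in P0
... | false = trans (P≡false i<L) (sym (cong (i <ᵇ_) (countBelow-none L λ j<L → subst T (P≡false (s<s j<L)))))
  where
  P≡false : ∀ {j} → j < suc L → P j ≡ false
  P≡false {j} j<L with P j in Pj
  ... | false = refl
  ... | true  = contradiction (subst T P0 (closed z≤n j<L (subst T (sym Pj) _))) id
countBelow-downClosed P (suc L) closed {zero}  i<L | true = P0
countBelow-downClosed P (suc L) closed {suc i} i<L | true =
  countBelow-downClosed (P ∘ suc) L (λ i≤j j<L → closed (s≤s i≤j) (s<s j<L)) (s<s⁻¹ i<L)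

countBelow-sparse : ∀ P L → (∀ {i} → suc i < L → T (P i) → ¬ T (P (suc i))) →
                    2 * countBelow P L ≤ suc L
countBelow-sparse P zero          _      = z≤n
countBelow-sparse P (suc zero)    _      with P 0
... | true  = ≤-refl
... | false = z≤n
countBelow-sparse P (suc (suc L)) sparse =
  step (P 0) (sparse {0} (s<s (s<s z≤n)))
    (countBelow-sparse (P ∘ suc) (suc L) (sparse ∘ s<s))
    (countBelow-sparse (λ i → P (2 + i)) L (sparse ∘ s<s ∘ s<s))
  where
  step : ∀ b → (T b → ¬ T (P 1)) →
         2 * countBelow (P ∘ suc) (suc L) ≤ suc (suc L) → 2 * countBelow (λ i → P (2 + i)) L ≤ suc L →
         2 * (fromBool b + countBelow (P ∘ suc) (suc L)) ≤ suc (suc (suc L))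
  step false _      bound₁ _      = ≤-trans bound₁ (n≤1+n _)
  step true  ¬P1    _      bound₂ with P 1 | ¬P1 _
  ... | false | _ = subst (_≤ suc (suc (suc L))) (sym (*-suc 2 _)) (s≤s (s≤s bound₂))
  ... | true  | ¬t = contradiction _ ¬t

double : ℕ → ℕ
double zero    = zero
double (suc k) = suc (suc (double k))

double≡+ : ∀ k → double k ≡ k + k
double≡+ zero    = refl
double≡+ (suc k) = cong suc (trans (cong suc (double≡+ k)) (sym (+-suc k k)))

even-or-odd : ∀ m → ∃[ k ] (m ≡ double k ⊎ m ≡ suc (double k))
even-or-odd zero = 0 , inj₁ refl
even-or-odd (suc m) with even-or-odd m
... | k , inj₁ m≡2k   = k , inj₂ (cong suc m≡2k)
... | k , inj₂ m≡2k+1 = suc k , inj₁ (cong suc m≡2k+1)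

double-mono-≤ : ∀ {a b} → a ≤ b → double a ≤ double b
double-mono-≤ z≤n       = z≤n
double-mono-≤ (s≤s a≤b) = s≤s (s≤s (double-mono-≤ a≤b))

odd<2* : ∀ {K x} → K < x → suc (double K) < 2 * x
odd<2* {K} {x} K<x = subst (suc (suc (double K)) ≤_) (trans (double≡+ x) (cong (x +_) (sym (+-identityʳ x))))
                           (double-mono-≤ K<x)

K<pred[n+K] : ∀ K {n} → 2 ≤ n → K < pred (n + K)
K<pred[n+K] K {suc (suc n)} _        = m<n+m K z<s
K<pred[n+K] K {suc zero}    (s≤s ())

≤1⇒≡0⊎≡1 : ∀ {q} → q ≤ 1 → q ≡ 0 ⊎ q ≡ 1
≤1⇒≡0⊎≡1 {zero}        _        = inj₁ refl
≤1⇒≡0⊎≡1 {suc zero}    _        = inj₂ refl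
≤1⇒≡0⊎≡1 {suc (suc _)} (s≤s ())

allB⇔All : ∀ {A : Set} (xs : List A) {p : A → Bool} → T (allB xs p) ⇔ All (T ∘ p) xs
allB⇔All []       = mk⇔ (λ _ → []) (λ _ → _)
allB⇔All (x ∷ xs) = mk⇔
  (λ px∧pxs → let px , pxs = Equivalence.to T-∧ px∧pxs in px ∷ Equivalence.to (allB⇔All xs) pxs)
  (λ { (px ∷ pxs) → Equivalence.from T-∧ (px , Equivalence.from (allB⇔All xs) pxs) })

allB-allFin⁻ : ∀ {N} {p : Fin N → Bool} → T (allB (allFin N) p) → ∀ x → T (p x)
allB-allFin⁻ {N} = Allₚ.tabulate⁻ ∘ Equivalence.to (allB⇔All (allFin N))

allB-allFin⁺ : ∀ {N} {p : Fin N → Bool} → (∀ x → T (p x)) → T (allB (allFin N) p)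
allB-allFin⁺ {N} = Equivalence.from (allB⇔All (allFin N)) ∘ Allₚ.tabulate⁺

allB-cong : ∀ {A : Set} (xs : List A) {p q : A → Bool} → (∀ x → p x ≡ q x) → allB xs p ≡ allB xs q
allB-cong []       _   = refl
allB-cong (x ∷ xs) p≡q = cong₂ _∧_ (p≡q x) (allB-cong xs p≡q)

count-∷ : ∀ {A : Set} (x : A) xs p → count (x ∷ xs) p ≡ fromBool (p x) + count xs p
count-∷ x xs p with p x
... | true  = refl
... | false = refl

count-tabulate : ∀ {A : Set} {N} (f : Fin N → A) (p : A → Bool) (P : ℕ → Bool) →
                 (∀ x → p (f x) ≡ P (toℕ x)) → count (tabulate f) p ≡ countBelow P N
count-tabulate {N = zero}  f p P _   = refl
count-tabulate {N = suc N} f p P p≡P = trans (count-∷ (f zero) _ p)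
  (cong₂ _+_ (cong fromBool (p≡P zero)) (count-tabulate (f ∘ suc) p (P ∘ suc) (p≡P ∘ suc)))

count-cong : ∀ {A : Set} (xs : List A) {p q : A → Bool} → (∀ x → p x ≡ q x) → count xs p ≡ count xs q
count-cong []       p≡q = refl
count-cong (x ∷ xs) {p} {q} p≡q = begin
  count (x ∷ xs) p            ≡⟨ count-∷ x xs p ⟩
  fromBool (p x) + count xs p ≡⟨ cong₂ _+_ (cong fromBool (p≡q x)) (count-cong xs p≡q) ⟩
  fromBool (q x) + count xs q ≡⟨ count-∷ x xs q ⟨
  count (x ∷ xs) q            ∎
  where open ≡-Reasoning

count-none : ∀ {A : Set} (xs : List A) {p : A → Bool} → (∀ x → ¬ T (p x)) → count xs p ≡ 0
count-none []       _  = refl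
count-none (x ∷ xs) {p} ¬p with p x | ¬p x
... | true  | ¬px = contradiction _ ¬px
... | false | _   = count-none xs ¬p

module _ {S : ℕ} ⦃ _ : NonZero S ⦄ where

  toℕ-mod : ∀ {i} → i < S → toℕ (i mod S) ≡ i
  toℕ-mod {i} i<S = trans (toℕ-fromℕ< (m%n<n i S)) (m<n⇒m%n≡m i<S)

  mod-toℕ : ∀ (x : Fin S) → toℕ x mod S ≡ x
  mod-toℕ x = toℕ-injective (toℕ-mod (toℕ<n x))

  count-allFin : ∀ (p : Fin S → Bool) → count (allFin S) p ≡ countBelow (λ i → p (i mod S)) S
  count-allFin p = count-tabulate id p _ (λ x → cong p (sym (mod-toℕ x)))

sum-map-tabulate-zero : ∀ {A : Set} {n} (g : Fin n → A) {f : A → ℕ} → (∀ i → f (g i) ≡ 0) →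
                        sum (map f (tabulate g)) ≡ 0
sum-map-tabulate-zero {n = zero}  g _   = refl
sum-map-tabulate-zero {n = suc n} g f≡0 = cong₂ _+_ (f≡0 zero) (sum-map-tabulate-zero (g ∘ suc) (f≡0 ∘ suc))

sum-map-mono : ∀ {A : Set} {f g : A → ℕ} {xs} → All (λ x → f x ≤ g x) xs → sum (map f xs) ≤ sum (map g xs)
sum-map-mono []         = z≤n
sum-map-mono (fx≤gx ∷ fxs≤gxs) = +-mono-≤ fx≤gx (sum-map-mono fxs≤gxs)

allPairs-restrict : ∀ {a r r′ p} {A : Set a} {R : A → A → Set r} {R′ : A → A → Set r′} {P : A → Set p} →
                    (∀ {x y} → P x → P y → R x y → R′ x y) → ∀ {xs} → All P xs → AllPairs R xs → AllPairs R′ xs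
allPairs-restrict f []         []         = []
allPairs-restrict f (px ∷ pxs) (rx ∷ rxs) =
  All.zipWith (λ (py , r) → f px py r) (pxs , rx) ∷ allPairs-restrict f pxs rxs

module _ {a ℓ} (S : Setoid a ℓ) where
  open Setoid S using (_≈_) renaming (sym to ≈-sym; trans to ≈-trans)
  open MembershipS S using (_∈_)
  open UniqueS S using (Unique)

  ∈-─ : ∀ {x y ys} (x∈ys : x ∈ ys) → y ∈ ys → ¬ y ≈ x → y ∈ (ys ─ x∈ys)
  ∈-─ (here x≈z) (here y≈z) y≉x = contradiction (≈-trans y≈z (≈-sym x≈z)) y≉x
  ∈-─ (here _)   (there y∈) _   = y∈
  ∈-─ (there _)  (here y≈z) _   = here y≈z
  ∈-─ (there x∈) (there y∈) y≉x = there (∈-─ x∈ y∈ y≉x)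

  pigeonhole : ∀ {xs ys} → Unique xs → All (_∈ ys) xs → length xs ≤ length ys
  pigeonhole []            []               = z≤n
  pigeonhole {ys = ys} (x≉xs ∷ xs!) (x∈ys ∷ xs⊆ys) =
    subst (_ ≤_) (sym (length-removeAt′ ys (Any.index x∈ys)))
      (s≤s (pigeonhole xs! (All.zipWith (λ (x≉y , y∈ys) → ∈-─ x∈ys y∈ys (x≉y ∘ ≈-sym))
                                        (x≉xs , xs⊆ys))))

module _ {ℓ} (S : Setoid 0ℓ ℓ) where
  open Setoid S using (_≈_) renaming (Carrier to A; sym to ≈-sym; trans to ≈-trans)
  open MembershipS S using (_∈_)
  open UniqueS S using (Unique)
  open VecEq S using (_≋_; ≋-setoid)

  _∈ᵛ_ : ∀ {k} → Vector A k → List (Vector A k) → Set _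
  _∈ᵛ_ {k} = MembershipS._∈_ (≋-setoid k)

  Uniqueᵛ : ∀ {k} → List (Vector A k) → Set _
  Uniqueᵛ {k} = UniqueS.Unique (≋-setoid k)

  module _ {bs : List A} where

    funs-complete : (∀ b → b ∈ bs) → ∀ k (f : Vector A k) → f ∈ᵛ funs k bs
    funs-complete bs∋ zero    f = here (λ ())
    funs-complete bs∋ (suc k) f = Anyₚ.concat⁺ (Anyₚ.map⁺ (Any.map inBlock (bs∋ (f zero))))
      where
      inBlock : ∀ {b} → f zero ≈ b → f ∈ᵛ map (b ∷ᶠ_) (funs k bs)
      inBlock f0≈b = Anyₚ.map⁺ (Any.map (λ tail≋ → λ { zero → f0≈b ; (suc i) → tail≋ i })
                                       (funs-complete bs∋ k (f ∘ suc)))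

    funs-unique : Unique bs → ∀ k → Uniqueᵛ (funs k bs)
    funs-unique bs! zero    = [] ∷ []
    funs-unique bs! (suc k) = UniqueSₚ.concat⁺ (≋-setoid (suc k))
        (Allₚ.map⁺ (All.universal (λ b → UniqueSₚ.map⁺ (≋-setoid k) (≋-setoid (suc k)) (_∘ suc) (funs-unique bs! k))
                                  bs))
        (AllPairsₚ.map⁺ (AllPairs.map disjoint bs!))
      where
      head≈ : ∀ {b v} → v ∈ᵛ map (b ∷ᶠ_) (funs k bs) → v zero ≈ b
      head≈ v∈ = proj₂ (Any.satisfied (Anyₚ.map⁻ v∈)) zero
      disjoint : ∀ {b b′} → ¬ b ≈ b′ →
                 ∀ {v} → ¬ (v ∈ᵛ map (b ∷ᶠ_) (funs k bs) × v ∈ᵛ map (b′ ∷ᶠ_) (funs k bs))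
      disjoint b≉b′ (v∈ , v∈′) = b≉b′ (≈-trans (≈-sym (head≈ v∈)) (head≈ v∈′))

  module CountFuns {bs : List A} (bs∋ : ∀ b → b ∈ bs) (bs! : Unique bs) {k : ℕ} where

    count-funs-≥ : ∀ {p : Vector A k → Bool} → (T ∘ p) Respects _≋_ →
                   ∀ {xs} → Uniqueᵛ xs → All (T ∘ p) xs → length xs ≤ count (funs k bs) p
    count-funs-≥ {p} p-resp xs! pxs = pigeonhole (≋-setoid k) xs!
      (All.map (λ {f} → MembershipSₚ.∈-filter⁺ (≋-setoid k) (T? ∘ p) p-resp (funs-complete bs∋ k f)) pxs)

    count-funs-≤ : ∀ {p : Vector A k → Bool} {ys} → (∀ {f} → T (p f) → f ∈ᵛ ys) →
                   count (funs k bs) p ≤ length ys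
    count-funs-≤ {p} covered = pigeonhole (≋-setoid k)
      (UniqueSₚ.filter⁺ (≋-setoid k) (T? ∘ p) (funs-unique bs! k))
      (All.map covered (Allₚ.all-filter (T? ∘ p) (funs k bs)))

    count-funs-mono : ∀ {p q : Vector A k → Bool} → (T ∘ q) Respects _≋_ → (F : Vector A k → Vector A k) →
                      (∀ {f} → T (p f) → T (q (F f))) →
                      (∀ {f g} → T (p f) → T (p g) → F f ≋ F g → f ≋ g) →
                      count (funs k bs) p ≤ count (funs k bs) q
    count-funs-mono {p} q-resp F pq F-inj = subst (_≤ _) (length-map F (filter (T? ∘ p) (funs k bs)))
      (count-funs-≥ q-resp
        (AllPairsₚ.map⁺ (allPairs-restrict (λ pf pg f≉g Ff≋Fg → f≉g (F-inj pf pg Ff≋Fg)) ps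
                         (UniqueSₚ.filter⁺ (≋-setoid k) (T? ∘ p) (funs-unique bs! k))))
        (Allₚ.map⁺ (All.map pq ps)))
      where
      ps : All (T ∘ p) (filter (T? ∘ p) (funs k bs))
      ps = Allₚ.all-filter (T? ∘ p) (funs k bs)

alternate : ℕ → ℕ → ℕ → ℕ
alternate a b zero    = a
alternate a b (suc i) = alternate b a i

alternate-double : ∀ a b k → alternate a b (double k) ≡ a
alternate-double a b zero    = refl
alternate-double a b (suc k) = alternate-double a b k

alternate-map : ∀ (f : ℕ → ℕ) a b i → f (alternate a b i) ≡ alternate (f a) (f b) i
alternate-map f a b zero    = refl
alternate-map f a b (suc i) = alternate-map f b a i

alternate-≤ : ∀ {a b c} → a ≤ c → b ≤ c → ∀ i → alternate a b i ≤ c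
alternate-≤ a≤c b≤c zero    = a≤c
alternate-≤ a≤c b≤c (suc i) = alternate-≤ b≤c a≤c i

alternate-≢ : ∀ {a b x} → a ≢ x → b ≢ x → ∀ i → alternate a b i ≢ x
alternate-≢ a≢x b≢x zero    = a≢x
alternate-≢ a≢x b≢x (suc i) = alternate-≢ b≢x a≢x i

alternate-adjacent : ∀ {a b} → a ≢ b → ∀ i → alternate a b i ≢ alternate a b (suc i)
alternate-adjacent a≢b zero    = a≢b
alternate-adjacent a≢b (suc i) = alternate-adjacent (a≢b ∘ sym) i

countBelow-alternate : ∀ P a b k → countBelow (P ∘ alternate a b) (double k) ≡ k * (fromBool (P a) + fromBool (P b))
countBelow-alternate P a b zero    = refl
countBelow-alternate P a b (suc k) =
  trans (sym (+-assoc (fromBool (P a)) _ _)) (cong (fromBool (P a) + fromBool (P b) +_) (countBelow-alternate P a b k))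

binary-flip : ∀ {a b} → a ≤ 1 → b ≤ 1 → a ≢ b → b ≡ 1 ∸ a
binary-flip {zero}        {zero}        _        _        a≢b = contradiction refl a≢b
binary-flip {zero}        {suc zero}    _        _        _   = refl
binary-flip {suc zero}    {zero}        _        _        _   = refl
binary-flip {suc zero}    {suc zero}    _        _        a≢b = contradiction refl a≢b
binary-flip {suc (suc _)} {_}           (s≤s ()) _        _
binary-flip {_}           {suc (suc _)} _        (s≤s ()) _

binary-path-alternates : ∀ (h : ℕ → ℕ) {L} → (∀ {i} → i < L → h i ≤ 1) →
                         (∀ {i} → suc i < L → h i ≢ h (suc i)) →
                         ∀ {i} → i < L → h i ≡ alternate (h 0) (1 ∸ h 0) i
binary-path-alternates h binary proper {zero}  _     = refl
binary-path-alternates h {L} binary proper {suc i} i+1<L = begin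
  h (suc i)                                       ≡⟨ binary-flip (binary i<L) (binary i+1<L) (proper i+1<L) ⟩
  1 ∸ h i                                         ≡⟨ cong (1 ∸_) (binary-path-alternates h binary proper i<L) ⟩
  1 ∸ alternate (h 0) (1 ∸ h 0) i                 ≡⟨ alternate-map (1 ∸_) (h 0) (1 ∸ h 0) i ⟩
  alternate (1 ∸ h 0) (1 ∸ (1 ∸ h 0)) i           ≡⟨ cong (λ x → alternate (1 ∸ h 0) x i) 1∸[1∸h₀]≡h₀ ⟩
  alternate (1 ∸ h 0) (h 0) i                     ∎
  where
  open ≡-Reasoning
  i<L : i < L
  i<L = <-trans (n<1+n i) i+1<L
  1∸[1∸h₀]≡h₀ : 1 ∸ (1 ∸ h 0) ≡ h 0
  1∸[1∸h₀]≡h₀ = m∸[m∸n]≡n (binary (<-trans z<s i+1<L))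

insertAt : ℕ → ℕ → (ℕ → ℕ) → ℕ → ℕ
insertAt zero    x f zero    = x
insertAt zero    x f (suc i) = f i
insertAt (suc t) x f zero    = f 0
insertAt (suc t) x f (suc i) = insertAt t x (f ∘ suc) i

insertAt-< : ∀ {t x f i} → i < t → insertAt t x f i ≡ f i
insertAt-< {suc t} {i = zero}  _         = refl
insertAt-< {suc t} {i = suc i} (s<s i<t) = insertAt-< i<t

insertAt-at : ∀ t {x f} → insertAt t x f t ≡ x
insertAt-at zero    = refl
insertAt-at (suc t) = insertAt-at t

insertAt-> : ∀ {t x f i} → t < i → insertAt t x f i ≡ f (pred i)
insertAt-> {zero}  {i = suc i} _         = refl
insertAt-> {suc t} {i = suc (suc i)} (s<s t<i+1) = insertAt-> {t} t<i+1

insertAt-≤ : ∀ {t x f c} → x ≤ c → (∀ i → f i ≤ c) → ∀ i → insertAt t x f i ≤ c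
insertAt-≤ {zero}  x≤c f≤c zero    = x≤c
insertAt-≤ {zero}  x≤c f≤c (suc i) = f≤c i
insertAt-≤ {suc t} x≤c f≤c zero    = f≤c 0
insertAt-≤ {suc t} x≤c f≤c (suc i) = insertAt-≤ {t} x≤c (f≤c ∘ suc) i

insertAt-const : ∀ {t x y i} → i ≢ t → insertAt t x (λ _ → y) i ≡ y
insertAt-const {t} {i = i} i≢t with <-cmp i t
... | tri< i<t _ _ = insertAt-< i<t
... | tri≈ _ i≡t _ = contradiction i≡t i≢t
... | tri> _ _ t<i = insertAt-> t<i

countBelow-insertAt : ∀ P {t x f L} → t ≤ L →
                      countBelow (P ∘ insertAt t x f) (suc L) ≡ countBelow (P ∘ f) L + fromBool (P x)
countBelow-insertAt P {zero}  {x} {f} {L}     _         = +-comm (fromBool (P x)) _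
countBelow-insertAt P {suc t} {x} {f} {suc L} (s≤s t≤L) =
  trans (cong (fromBool (P (f 0)) +_) (countBelow-insertAt P {t} {x} {f ∘ suc} t≤L))
        (sym (+-assoc (fromBool (P (f 0))) _ _))

insertAt-adjacent : ∀ {t x f L} → t ≤ L → (∀ {i} → suc i < L → f i ≢ f (suc i)) → (∀ i → f i ≢ x) →
                    ∀ {i} → i < L → insertAt t x f i ≢ insertAt t x f (suc i)
insertAt-adjacent {t} {x} {f} t≤L f-adjacent f≢x {i} i<L with <-cmp (suc i) t
... | tri< i+1<t _ _ rewrite insertAt-< {t} {x} {f} (<-trans (n<1+n i) i+1<t) | insertAt-< {t} {x} {f} i+1<t =
  f-adjacent (<-≤-trans i+1<t t≤L)
... | tri≈ _ refl _ rewrite insertAt-< {suc i} {x} {f} (n<1+n i) | insertAt-at (suc i) {x} {f} = f≢x i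
... | tri> _ _ t<i+1 with m≤n⇒m<n∨m≡n (s≤s⁻¹ t<i+1)
...   | inj₂ refl rewrite insertAt-at t {x} {f} | insertAt-> {t} {x} {f} t<i+1 = f≢x t ∘ sym
...   | inj₁ t<i@(s≤s _) rewrite insertAt-> {t} {x} {f} t<i | insertAt-> {t} {x} {f} t<i+1 = f-adjacent i<L

insertAt-alternate-adjacent : ∀ {t x a b L} → t ≤ L → a ≢ b → a ≢ x → b ≢ x →
                              ∀ {i} → i < L → insertAt t x (alternate a b) i ≢ insertAt t x (alternate a b) (suc i)
insertAt-alternate-adjacent {t} {x} {a} {b} t≤L a≢b a≢x b≢x =
  insertAt-adjacent {t} {x} {alternate a b} t≤L (λ {i} _ → alternate-adjacent a≢b i) (alternate-≢ a≢x b≢x)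

append : ℕ → (ℕ → ℕ) → (ℕ → ℕ) → ℕ → ℕ
append zero    f g i       = g i
append (suc m) f g zero    = f 0
append (suc m) f g (suc i) = append m (f ∘ suc) g i

append-< : ∀ {m f g i} → i < m → append m f g i ≡ f i
append-< {suc m} {i = zero}  _         = refl
append-< {suc m} {i = suc i} (s<s i<m) = append-< {m} i<m

append-+ : ∀ m {f g} j → append m f g (m + j) ≡ g j
append-+ zero    j = refl
append-+ (suc m) j = append-+ m j

append-≤ : ∀ {m f g c} → (∀ i → f i ≤ c) → (∀ j → g j ≤ c) → ∀ i → append m f g i ≤ c
append-≤ {zero}  f≤c g≤c i       = g≤c i
append-≤ {suc m} f≤c g≤c zero    = f≤c 0
append-≤ {suc m} f≤c g≤c (suc i) = append-≤ {m} (f≤c ∘ suc) g≤c i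

countBelow-append : ∀ P m {f g} n →
                    countBelow (P ∘ append m f g) (m + n) ≡ countBelow (P ∘ f) m + countBelow (P ∘ g) n
countBelow-append P zero    n = refl
countBelow-append P (suc m) {f} n =
  trans (cong (fromBool (P (f 0)) +_) (countBelow-append P m {f ∘ suc} n)) (sym (+-assoc (fromBool (P (f 0))) _ _))

countBelow-const : ∀ b n → countBelow (λ _ → b) n ≡ n * fromBool b
countBelow-const b zero    = refl
countBelow-const b (suc n) = cong (fromBool b +_) (countBelow-const b n)

-- Kostka numbers

shift : (ℕ → ℕ) → ℕ → ℕ
shift w zero          = pred (w 0)
shift w (suc zero)    = suc (w 1)
shift w (suc (suc i)) = w (suc (suc i))

isPartition⇒antitone : ∀ {S} {shape : Fin S → Fin (suc S)} → T (isPartition S shape) →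
                       ∀ {r r′} → toℕ r < toℕ r′ → toℕ (shape r′) ≤ toℕ (shape r)
isPartition⇒antitone {S} {shape} ok {r} {r′} r<r′ =
  ≤ᵇ⇒≤ _ _ (T-⇒ (allB-allFin⁻ (allB-allFin⁻ (T-∧⁻ʳ {sumF (toℕ ∘ shape) ≡ᵇ S} ok) r) r′) (<⇒<ᵇ r<r′))

module Tableaux {S : ℕ} (shape : Fin S → Fin (suc S)) where

  Tableau : Set
  Tableau = Fin S → Fin S → Fin S

  InShape : Fin S → Fin S → Set
  InShape r c = toℕ c < toℕ (shape r)

  record IsSSYT (t : Tableau) : Set where
    field
      outside-zero : ∀ r c → InShape r c ⊎ toℕ (t r c) ≡ 0
      row-weak     : ∀ r {c c′} → InShape r c → InShape r c′ → toℕ c < toℕ c′ → toℕ (t r c) ≤ toℕ (t r c′)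
      col-strict   : ∀ {r r′} c → InShape r c → InShape r′ c → toℕ r < toℕ r′ → toℕ (t r c) < toℕ (t r′ c)

  private
    outsideᵇ : Tableau → Fin S → Fin S → Bool
    outsideᵇ t r c = inShape shape r c ∨ (toℕ (t r c) ≡ᵇ 0)

    rowᵇ : Tableau → Fin S → Fin S → Fin S → Bool
    rowᵇ t r c c′ = not (inShape shape r c ∧ inShape shape r c′ ∧ (toℕ c <ᵇ toℕ c′))
                    ∨ (toℕ (t r c) ≤ᵇ toℕ (t r c′))

    colᵇ : Tableau → Fin S → Fin S → Fin S → Bool
    colᵇ t r c r′ = not (inShape shape r c ∧ inShape shape r′ c ∧ (toℕ r <ᵇ toℕ r′))
                    ∨ (toℕ (t r c) <ᵇ toℕ (t r′ c))

  isSSYT⁻ : ∀ {t} → T (isSSYT S shape t) → IsSSYT t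
  isSSYT⁻ {t} ok = record { outside-zero = outside ; row-weak = rows ; col-strict = cols }
    where
    cell : ∀ r c → T (outsideᵇ t r c) × T (allB (allFin S) (rowᵇ t r c)) × T (allB (allFin S) (colᵇ t r c))
    cell r c = T-∧³⁻ {outsideᵇ t r c} {allB (allFin S) (rowᵇ t r c)} (allB-allFin⁻ {S} (allB-allFin⁻ {S} ok r) c)
    outside : ∀ r c → InShape r c ⊎ toℕ (t r c) ≡ 0
    outside r c = Sum.map (<ᵇ⇒< _ _) (≡ᵇ⇒≡ _ 0) (Equivalence.to (T-∨ {inShape shape r c}) (proj₁ (cell r c)))
    rows : ∀ r {c c′} → InShape r c → InShape r c′ → toℕ c < toℕ c′ → toℕ (t r c) ≤ toℕ (t r c′)
    rows r {c} {c′} in₁ in₂ c<c′ = ≤ᵇ⇒≤ _ _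
      (T-⇒ (allB-allFin⁻ {S} (proj₁ (proj₂ (cell r c))) c′) (T-∧³ (<⇒<ᵇ in₁) (<⇒<ᵇ in₂) (<⇒<ᵇ c<c′)))
    cols : ∀ {r r′} c → InShape r c → InShape r′ c → toℕ r < toℕ r′ → toℕ (t r c) < toℕ (t r′ c)
    cols {r} {r′} c in₁ in₂ r<r′ = <ᵇ⇒< _ _
      (T-⇒ (allB-allFin⁻ {S} (proj₂ (proj₂ (cell r c))) r′) (T-∧³ (<⇒<ᵇ in₁) (<⇒<ᵇ in₂) (<⇒<ᵇ r<r′)))

  isSSYT⁺ : ∀ {t} → IsSSYT t → T (isSSYT S shape t)
  isSSYT⁺ {t} ssyt = allB-allFin⁺ λ r → allB-allFin⁺ λ c →
    T-∧³ {outsideᵇ t r c} {allB (allFin S) (rowᵇ t r c)} {allB (allFin S) (colᵇ t r c)}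
      (Equivalence.from T-∨ (Sum.map <⇒<ᵇ (≡⇒≡ᵇ _ 0) (outside-zero r c)))
      (allB-allFin⁺ λ c′ → T-⇒⁺ λ conds →
        let in₁ , in₂ , c<c′ = T-∧³⁻ {inShape shape r c} {inShape shape r c′} conds in
        ≤⇒≤ᵇ (row-weak r (<ᵇ⇒< _ _ in₁) (<ᵇ⇒< _ _ in₂) (<ᵇ⇒< _ _ c<c′)))
      (allB-allFin⁺ λ r′ → T-⇒⁺ λ conds →
        let in₁ , in₂ , r<r′ = T-∧³⁻ {inShape shape r c} {inShape shape r′ c} conds in
        <⇒<ᵇ (col-strict c (<ᵇ⇒< _ _ in₁) (<ᵇ⇒< _ _ in₂) (<ᵇ⇒< _ _ r<r′)))
    where open IsSSYT ssyt

  _≋ᵗ_ : Tableau → Tableau → Set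
  t ≋ᵗ u = ∀ r c → t r c ≡ u r c

  IsSSYT-resp : ∀ {t u} → t ≋ᵗ u → IsSSYT t → IsSSYT u
  IsSSYT-resp t≋u ssyt = record
    { outside-zero = λ r c → subst (λ x → InShape r c ⊎ toℕ x ≡ 0) (t≋u r c) (outside-zero r c)
    ; row-weak = λ r {c} {c′} in₁ in₂ c<c′ →
        subst₂ (λ x y → toℕ x ≤ toℕ y) (t≋u r c) (t≋u r c′) (row-weak r in₁ in₂ c<c′)
    ; col-strict = λ {r} {r′} c in₁ in₂ r<r′ →
        subst₂ (λ x y → toℕ x < toℕ y) (t≋u r c) (t≋u r′ c) (col-strict c in₁ in₂ r<r′)
    }
    where open IsSSYT ssyt

  rowCount : Tableau → Fin S → Fin S → ℕ
  rowCount t r k = count (allFin S) (λ c → inShape shape r c ∧ (t r c =ᶠ k))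

  HasContent : Tableau → (Fin S → ℕ) → Set
  HasContent t α = ∀ k → sumF (λ r → rowCount t r k) ≡ α k

  tabContent⁻ : ∀ {t α} → T (tabContent S shape t α) → HasContent t α
  tabContent⁻ ok k = ≡ᵇ⇒≡ _ _ (allB-allFin⁻ {S} ok k)

  tabContent⁺ : ∀ {t α} → HasContent t α → T (tabContent S shape t α)
  tabContent⁺ content = allB-allFin⁺ λ k → ≡⇒≡ᵇ _ _ (content k)

  HasContent-resp : ∀ {t u α} → t ≋ᵗ u → HasContent t α → HasContent u α
  HasContent-resp {t} {u} t≋u content k = trans
    (cong sum (map-cong (λ r → count-cong (allFin S) λ c → cong (λ x → inShape shape r c ∧ (x =ᶠ k)) (sym (t≋u r c)))
                        (allFin S)))
    (content k)

  ssytWithContent : (Fin S → ℕ) → Tableau → Bool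
  ssytWithContent α t = isSSYT S shape t ∧ tabContent S shape t α

  ssytWithContent⁻ : ∀ {α t} → T (ssytWithContent α t) → IsSSYT t × HasContent t α
  ssytWithContent⁻ {α} {t} ok = let ssyt , content = Equivalence.to (T-∧ {isSSYT S shape t}) ok in
    isSSYT⁻ ssyt , tabContent⁻ {t} content

  ssytWithContent⁺ : ∀ {α t} → IsSSYT t → HasContent t α → T (ssytWithContent α t)
  ssytWithContent⁺ {α} {t} ssyt content = Equivalence.from T-∧ (isSSYT⁺ ssyt , tabContent⁺ {t} content)

  ssytWithContent-resp : ∀ {α t u} → t ≋ᵗ u → T (ssytWithContent α t) → T (ssytWithContent α u)
  ssytWithContent-resp {α} {t} {u} t≋u ok = let ssyt , content = ssytWithContent⁻ ok in
    ssytWithContent⁺ (IsSSYT-resp t≋u ssyt) (HasContent-resp {t} {u} t≋u content)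

module Kostka {M : ℕ} (shape : Fin (2 + M) → Fin (3 + M))
              (antitone : ∀ {r r′} → toℕ r < toℕ r′ → toℕ (shape r′) ≤ toℕ (shape r))
              (w : ℕ → ℕ) (w₁<w₀ : w 1 < w 0) where

  open Tableaux shape

  z : ℕ
  z = w 0

  -- The zeros of a tableau of content w are exactly the first z cells of row 0.
  lastZero : Fin (2 + M)
  lastZero = pred z mod (2 + M)

  raise : Tableau → Tableau
  raise t zero    c with c ≟ᶠ lastZero
  ... | yes _ = suc zero
  ... | no  _ = t zero c
  raise t (suc r) c = t (suc r) c

  raise-at : ∀ t → raise t zero lastZero ≡ suc zero
  raise-at t with lastZero ≟ᶠ lastZero
  ... | yes _   = refl
  ... | no  ¬eq = contradiction refl ¬eq

  raise-off : ∀ t {c} → c ≢ lastZero → raise t zero c ≡ t zero c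
  raise-off t {c} c≢lastZero with c ≟ᶠ lastZero
  ... | yes c≡lastZero = contradiction c≡lastZero c≢lastZero
  ... | no  _          = refl

  shift-content : ∀ (k : Fin (2 + M)) {new old rest} →
                  new + fromBool (0 ≡ᵇ toℕ k) ≡ old + fromBool (1 ≡ᵇ toℕ k) →
                  old + rest ≡ w (toℕ k) → new + rest ≡ shift w (toℕ k)
  shift-content zero {new} {old} {rest} moved content₀ =
    cong pred (trans (cong (_+ rest) (trans (+-comm 1 new) (trans moved (+-identityʳ old)))) content₀)
  shift-content (suc zero) {new} {old} {rest} moved content₁ =
    trans (cong (_+ rest) (trans (sym (+-identityʳ new)) (trans moved (+-comm old 1)))) (cong suc content₁)
  shift-content (suc (suc k)) {new} {old} {rest} unchanged contentₖ =
    trans (cong (_+ rest) (+-cancelʳ-≡ 0 new old unchanged)) contentₖ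

  module _ {t : Tableau} (ssyt : IsSSYT t) (content : HasContent t (w ∘ toℕ)) where
    open IsSSYT ssyt

    row≤entry : ∀ r {c} → InShape r c → toℕ r ≤ toℕ (t r c)
    row≤entry r = go (toℕ r) r refl
      where
      go : ∀ j r {c} → toℕ r ≡ j → InShape r c → j ≤ toℕ (t r c)
      go zero    r       _  _ = z≤n
      go (suc j) zero    () _
      go (suc j) (suc r) {c} r≡ inS = ≤-<-trans (go j (inject₁ r) r₋≡ inS₋) (col-strict c inS₋ inS r₋<r)
        where
        r₋≡ : toℕ (inject₁ r) ≡ j
        r₋≡ = trans (toℕ-inject₁ r) (suc-injective r≡)
        r₋<r : toℕ (inject₁ r) < toℕ (suc r)
        r₋<r = s≤s (≤-reflexive (toℕ-inject₁ r))
        inS₋ : InShape (inject₁ r) c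
        inS₋ = <-≤-trans inS (antitone r₋<r)

    zeroAt : ℕ → Bool
    zeroAt i = inShape shape zero (i mod (2 + M)) ∧ (t zero (i mod (2 + M)) =ᶠ zero)

    zeroAt⇔ : ∀ c → T (zeroAt (toℕ c)) ⇔ (InShape zero c × toℕ (t zero c) ≡ 0)
    zeroAt⇔ c rewrite mod-toℕ c = mk⇔
      (λ ok → let inS , isZero = Equivalence.to (T-∧ {inShape shape zero c}) ok in <ᵇ⇒< _ _ inS , ≡ᵇ⇒≡ _ 0 isZero)
      (λ (inS , isZero) → Equivalence.from T-∧ (<⇒<ᵇ inS , ≡⇒≡ᵇ _ 0 isZero))

    lower-rows-without-zeros : ∀ r → rowCount t (suc r) zero ≡ 0
    lower-rows-without-zeros r = count-none (allFin _) λ c ok →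
      let inS , isZero = Equivalence.to (T-∧ {inShape shape (suc r) c}) ok in
      contradiction (subst (suc (toℕ r) ≤_) (≡ᵇ⇒≡ _ 0 isZero) (row≤entry (suc r) (<ᵇ⇒< _ _ inS))) λ ()

    zeros-in-row₀ : countBelow zeroAt (2 + M) ≡ z
    zeros-in-row₀ = begin
      countBelow zeroAt (2 + M)        ≡⟨ count-allFin (λ c → inShape shape zero c ∧ (t zero c =ᶠ zero)) ⟨
      rowCount t zero zero             ≡⟨ +-identityʳ _ ⟨
      rowCount t zero zero + 0         ≡⟨ cong (rowCount t zero zero +_) (sum-map-tabulate-zero suc lower-rows-without-zeros) ⟨
      sumF (λ r → rowCount t r zero)  ≡⟨ content zero ⟩
      z                                ∎
      where open ≡-Reasoning

    zeroAt-closed : ∀ {i j} → i ≤ j → j < 2 + M → T (zeroAt j) → T (zeroAt i)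
    zeroAt-closed {i} {j} i≤j j<S zj with m≤n⇒m<n∨m≡n i≤j
    ... | inj₂ refl = zj
    ... | inj₁ i<j  = subst (T ∘ zeroAt) (toℕ-mod i<S) (Equivalence.from (zeroAt⇔ (i mod (2 + M)))
      (inSᵢ , n≤0⇒n≡0 (subst (_ ≤_) isZero (row-weak zero inSᵢ inS i<j′))))
      where
      i<S : i < 2 + M
      i<S = <-trans i<j j<S
      zj′ : InShape zero (j mod (2 + M)) × toℕ (t zero (j mod (2 + M))) ≡ 0
      zj′ = Equivalence.to (zeroAt⇔ (j mod (2 + M))) (subst (T ∘ zeroAt) (sym (toℕ-mod j<S)) zj)
      inS : InShape zero (j mod (2 + M))
      inS = proj₁ zj′
      isZero : toℕ (t zero (j mod (2 + M))) ≡ 0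
      isZero = proj₂ zj′
      i<j′ : toℕ (i mod (2 + M)) < toℕ (j mod (2 + M))
      i<j′ = subst₂ _<_ (sym (toℕ-mod i<S)) (sym (toℕ-mod j<S)) i<j
      inSᵢ : InShape zero (i mod (2 + M))
      inSᵢ = <-trans i<j′ inS

    row₀-zeros : ∀ c → (InShape zero c × toℕ (t zero c) ≡ 0) ⇔ toℕ c < z
    row₀-zeros c = mk⇔
      (λ zero-at-c → <ᵇ⇒< _ _ (subst T zeroAt≡ (Equivalence.from (zeroAt⇔ c) zero-at-c)))
      (λ c<z → Equivalence.to (zeroAt⇔ c) (subst T (sym zeroAt≡) (<⇒<ᵇ c<z)))
      where
      zeroAt≡ : zeroAt (toℕ c) ≡ (toℕ c <ᵇ z)
      zeroAt≡ = trans (countBelow-downClosed zeroAt (2 + M) zeroAt-closed (toℕ<n c)) (cong (toℕ c <ᵇ_) zeros-in-row₀)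

    suc-pred-z : suc (pred z) ≡ z
    suc-pred-z = suc-pred z ⦃ >-nonZero (≤-<-trans z≤n w₁<w₀) ⦄

    z≤S : z ≤ 2 + M
    z≤S = subst (_≤ 2 + M) zeros-in-row₀ (countBelow≤ zeroAt (2 + M))

    toℕ-lastZero : toℕ lastZero ≡ pred z
    toℕ-lastZero = toℕ-mod (subst (_≤ 2 + M) (sym suc-pred-z) z≤S)

    lastZero<z : toℕ lastZero < z
    lastZero<z = subst (_≤ z) (cong suc (sym toℕ-lastZero)) (≤-reflexive suc-pred-z)

    lastZero-zero : InShape zero lastZero × toℕ (t zero lastZero) ≡ 0
    lastZero-zero = Equivalence.from (row₀-zeros lastZero) lastZero<z

    left-of-lastZero : ∀ {c} → toℕ c < toℕ lastZero → toℕ (t zero c) ≡ 0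
    left-of-lastZero {c} c<lastZero = proj₂ (Equivalence.from (row₀-zeros c) (<-trans c<lastZero lastZero<z))

    right-of-lastZero : ∀ {c} → toℕ lastZero < toℕ c → InShape zero c → 0 < toℕ (t zero c)
    right-of-lastZero {c} lastZero<c inS with toℕ (t zero c) in entry
    ... | suc _ = z<s
    ... | zero  = contradiction (Equivalence.to (row₀-zeros c) (inS , entry))
                    (≤⇒≯ (subst (_≤ toℕ c) (trans (cong suc toℕ-lastZero) suc-pred-z) lastZero<c))

    ones-in-row₁≤ : rowCount t (suc zero) (suc zero) ≤ w 1
    ones-in-row₁≤ = subst (rowCount t (suc zero) (suc zero) ≤_) (content (suc zero))
      (≤-trans (m≤m+n _ _) (m≤n+m _ (rowCount t zero (suc zero))))

    below-lastZero : InShape (suc zero) lastZero → 2 ≤ toℕ (t (suc zero) lastZero)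
    below-lastZero inS with toℕ (t (suc zero) lastZero) in entry | row≤entry (suc zero) inS
    ... | suc (suc _) | _ = s≤s (s≤s z≤n)
    ... | suc zero    | _ = contradiction (≤-trans z≤ones ones-in-row₁≤) (<⇒≱ w₁<w₀)
      where
      one-at : ∀ {i} → i < z → T (inShape shape (suc zero) (i mod (2 + M)) ∧ (t (suc zero) (i mod (2 + M)) =ᶠ suc zero))
      one-at {i} i<z = Equivalence.from T-∧ (<⇒<ᵇ inSᵢ , ≡⇒≡ᵇ _ 1 (≤-antisym ≤1 (row≤entry (suc zero) inSᵢ)))
        where
        i≤lastZero : toℕ (i mod (2 + M)) ≤ toℕ lastZero
        i≤lastZero = subst₂ _≤_ (sym (toℕ-mod (<-≤-trans i<z z≤S)))
                          (sym toℕ-lastZero) (≤-pred (subst (suc i ≤_) (sym suc-pred-z) i<z))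
        inSᵢ : InShape (suc zero) (i mod (2 + M))
        inSᵢ = ≤-<-trans i≤lastZero inS
        ≤1 : toℕ (t (suc zero) (i mod (2 + M))) ≤ 1
        ≤1 with m≤n⇒m<n∨m≡n i≤lastZero
        ... | inj₁ i<lastZero = subst (_ ≤_) entry (row-weak (suc zero) inSᵢ inS i<lastZero)
        ... | inj₂ i≡lastZero =
          subst (_≤ 1) (cong (toℕ ∘ t (suc zero)) (sym (toℕ-injective i≡lastZero))) (≤-reflexive entry)
      z≤ones : z ≤ rowCount t (suc zero) (suc zero)
      z≤ones = subst (z ≤_) (sym (count-allFin (λ c → inShape shape (suc zero) c ∧ (t (suc zero) c =ᶠ suc zero))))
        (countBelow-≥ z (2 + M) z≤S one-at)

    raise-IsSSYT : IsSSYT (raise t)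
    raise-IsSSYT = record { outside-zero = outside′ ; row-weak = rows′ ; col-strict = cols′ }
      where
      outside′ : ∀ r c → InShape r c ⊎ toℕ (raise t r c) ≡ 0
      outside′ zero c with c ≟ᶠ lastZero
      ... | yes refl = inj₁ (proj₁ lastZero-zero)
      ... | no  _    = outside-zero zero c
      outside′ (suc r) c = outside-zero (suc r) c

      rows′ : ∀ r {c c′} → InShape r c → InShape r c′ → toℕ c < toℕ c′ →
              toℕ (raise t r c) ≤ toℕ (raise t r c′)
      rows′ (suc r) = row-weak (suc r)
      rows′ zero {c} {c′} inS inS′ c<c′ with c ≟ᶠ lastZero | c′ ≟ᶠ lastZero
      ... | yes refl | yes refl = contradiction c<c′ (<-irrefl refl)
      ... | yes refl | no  _    = right-of-lastZero c<c′ inS′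
      ... | no  _    | yes refl = subst (_≤ 1) (sym (left-of-lastZero c<c′)) z≤n
      ... | no  _    | no  _    = row-weak zero inS inS′ c<c′

      cols′ : ∀ {r r′} c → InShape r c → InShape r′ c → toℕ r < toℕ r′ →
              toℕ (raise t r c) < toℕ (raise t r′ c)
      cols′ {suc r} {suc r′} c = col-strict c
      cols′ {zero}  {suc r′} c inS inS′ r<r′ with c ≟ᶠ lastZero
      ... | no  _    = col-strict c inS inS′ r<r′
      ... | yes refl = below r′ inS′
        where
        below : ∀ r′ → InShape (suc r′) lastZero → 1 < toℕ (t (suc r′) lastZero)
        below zero     = below-lastZero
        below (suc r″) inS″ = ≤-trans (s≤s (s≤s z≤n)) (row≤entry (suc (suc r″)) inS″)

    row₀-update : ∀ k → rowCount (raise t) zero k + fromBool (0 ≡ᵇ toℕ k)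
                      ≡ rowCount t zero k + fromBool (1 ≡ᵇ toℕ k)
    row₀-update k = begin
      rowCount (raise t) zero k + fromBool (0 ≡ᵇ toℕ k)
        ≡⟨ cong₂ _+_ (count-allFin raised) (cong fromBool (sym original-at-lastZero)) ⟩
      countBelow (λ i → raised (i mod (2 + M))) (2 + M) + fromBool (original (toℕ lastZero mod (2 + M)))
        ≡⟨ countBelow-update _ _ (2 + M) (toℕ<n lastZero) agree ⟩
      countBelow (λ i → original (i mod (2 + M))) (2 + M) + fromBool (raised (toℕ lastZero mod (2 + M)))
        ≡⟨ cong₂ _+_ (sym (count-allFin original)) (cong fromBool raised-at-lastZero) ⟩
      rowCount t zero k + fromBool (1 ≡ᵇ toℕ k) ∎
      where
      open ≡-Reasoning
      raised original : Fin (2 + M) → Bool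
      raised   c = inShape shape zero c ∧ (raise t zero c =ᶠ k)
      original c = inShape shape zero c ∧ (t zero c =ᶠ k)
      lastZero-inShape : inShape shape zero lastZero ≡ true
      lastZero-inShape = Equivalence.to T-≡ (<⇒<ᵇ (proj₁ lastZero-zero))
      original-at-lastZero : original (toℕ lastZero mod (2 + M)) ≡ (0 ≡ᵇ toℕ k)
      original-at-lastZero = trans (cong original (mod-toℕ lastZero))
        (cong₂ _∧_ lastZero-inShape (cong (_≡ᵇ toℕ k) (proj₂ lastZero-zero)))
      raised-at-lastZero : raised (toℕ lastZero mod (2 + M)) ≡ (1 ≡ᵇ toℕ k)
      raised-at-lastZero = trans (cong raised (mod-toℕ lastZero))
        (cong₂ _∧_ lastZero-inShape (cong (λ x → toℕ x ≡ᵇ toℕ k) (raise-at t)))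
      agree : ∀ {i} → i < 2 + M → i ≢ toℕ lastZero → raised (i mod (2 + M)) ≡ original (i mod (2 + M))
      agree i<S i≢lastZero = cong (λ x → inShape shape zero _ ∧ (x =ᶠ k))
        (raise-off t λ i≡lastZero → i≢lastZero (trans (sym (toℕ-mod i<S)) (cong toℕ i≡lastZero)))

    raise-content : HasContent (raise t) (shift w ∘ toℕ)
    raise-content k = trans (cong (rowCount (raise t) zero k +_) lower-rows-unchanged)
                            (shift-content k (row₀-update k) (content k))
      where
      lower-rows-unchanged : sum (map (λ r → rowCount (raise t) r k) (tabulate suc))
                           ≡ sum (map (λ r → rowCount t r k) (tabulate suc))
      lower-rows-unchanged = trans (cong sum (map-tabulate {n = suc M} suc (λ r → rowCount (raise t) r k)))
                                     (sym (cong sum (map-tabulate {n = suc M} suc (λ r → rowCount t r k))))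

  raise-injective : ∀ {t u} → IsSSYT t → HasContent t (w ∘ toℕ) → IsSSYT u → HasContent u (w ∘ toℕ) →
                    raise t ≋ᵗ raise u → t ≋ᵗ u
  raise-injective {t} {u} ssytₜ contentₜ ssytᵤ contentᵤ raised≋ zero c with c ≟ᶠ lastZero
  ... | yes refl =
    toℕ-injective (trans (proj₂ (lastZero-zero ssytₜ contentₜ)) (sym (proj₂ (lastZero-zero ssytᵤ contentᵤ))))
  ... | no  c≢lastZero = trans (sym (raise-off t c≢lastZero)) (trans (raised≋ zero c) (raise-off u c≢lastZero))
  raise-injective ssytₜ contentₜ ssytᵤ contentᵤ raised≋ (suc r) c = raised≋ (suc r) c

kostka-shift : ∀ {M} (shape : Fin (2 + M) → Fin (3 + M)) (w : ℕ → ℕ) → T (isPartition (2 + M) shape) →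
               w 1 < w 0 → schurCoeff (2 + M) shape (w ∘ toℕ) ≤ schurCoeff (2 + M) shape (shift w ∘ toℕ)
kostka-shift {M} shape w partition w₁<w₀ =
  count-funs-mono (λ {t} {u} → ssytWithContent-resp {shift w ∘ toℕ} {t} {u}) raise
    (λ ok → let ssyt , content = ssytWithContent⁻ ok in
            ssytWithContent⁺ (raise-IsSSYT ssyt content) (raise-content ssyt content))
    (λ okₜ okᵤ → let ssytₜ , contentₜ = ssytWithContent⁻ okₜ ; ssytᵤ , contentᵤ = ssytWithContent⁻ okᵤ in
                 raise-injective ssytₜ contentₜ ssytᵤ contentᵤ)
  where
  open Tableaux shape
  open Kostka shape (isPartition⇒antitone partition) w w₁<w₀
  open CountFuns (VecEq.≋-setoid (setoid (Fin (2 + M))) (2 + M))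
    (funs-complete (setoid (Fin (2 + M))) ∈-allFin (2 + M)) (funs-unique (setoid (Fin (2 + M))) (allFin⁺ (2 + M)) (2 + M))
    {2 + M}

-- Chromatic coefficients

schurPositive⇒chromCoeff-shift : ∀ {M} (adj : Fin (2 + M) → Fin (2 + M) → Bool) →
  SchurPositive (record { V = 2 + M ; adj = adj }) → ∀ w → w 1 < w 0 →
  chromCoeff (record { V = 2 + M ; adj = adj }) (w ∘ toℕ) ≤ chromCoeff (record { V = 2 + M ; adj = adj }) (shift w ∘ toℕ)
schurPositive⇒chromCoeff-shift {M} adj (c , expansion) w w₁<w₀ =
  subst₂ _≤_ (sym (expansion (w ∘ toℕ))) (sym (expansion (shift w ∘ toℕ)))
    (sum-map-mono (All.map (λ {l} partition → *-monoʳ-≤ (c l) (kostka-shift l w partition w₁<w₀))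
                           (Allₚ.all-filter (T? ∘ isPartition (2 + M)) (funs (2 + M) (allFin (3 + M))))))

colouringWith : (G : Graph) → (Fin (V G) → ℕ) → (Fin (V G) → Fin (V G)) → Bool
colouringWith G α κ = isProper G κ ∧ colContent G κ α

colouringWith-cong : ∀ G α {κ κ′} → (∀ x → κ x ≡ κ′ x) → colouringWith G α κ ≡ colouringWith G α κ′
colouringWith-cong G α κ≗κ′ = cong₂ _∧_
  (allB-cong (allFin (V G)) λ x → allB-cong (allFin (V G)) λ y →
     cong₂ (λ a b → not (adj G x y) ∨ not (a =ᶠ b)) (κ≗κ′ x) (κ≗κ′ y))
  (allB-cong (allFin (V G)) λ k → cong (_≡ᵇ α k) (count-cong (allFin (V G)) λ v → cong (_=ᶠ k) (κ≗κ′ v)))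

module ChromaticBounds (G : Graph) (α : Fin (V G) → ℕ) where

  open CountFuns (setoid (Fin (V G))) ∈-allFin (allFin⁺ (V G)) {V G}

  chromCoeff-≥ : ∀ {κs} → Uniqueᵛ (setoid (Fin (V G))) κs → All (T ∘ colouringWith G α) κs →
                 length κs ≤ chromCoeff G α
  chromCoeff-≥ = count-funs-≥ λ κ≗κ′ → subst T (colouringWith-cong G α κ≗κ′)

  chromCoeff-≤ : ∀ {κs} → (∀ {κ} → T (colouringWith G α κ) → _∈ᵛ_ (setoid (Fin (V G))) κ κs) →
                 chromCoeff G α ≤ length κs
  chromCoeff-≤ = count-funs-≤

-- Colourings of the squid graph

module SquidColourings (m′ n : ℕ) where

  m N : ℕ
  m = 3 + m′
  N = m + n

  data Edge : ℕ → ℕ → Set where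
    path  : ∀ {i} → suc i < m → Edge i (suc i)
    close : Edge 0 (2 + m′)
    leaf  : ∀ {j} → j < n → Edge 0 (m + j)

  edge-bounded : ∀ {a b} → Edge a b → a < N × b < N
  edge-bounded (path i+1<m) = <-≤-trans (<-trans (n<1+n _) i+1<m) (m≤m+n m n) , <-≤-trans i+1<m (m≤m+n m n)
  edge-bounded close        = z<s , <-≤-trans (n<1+n (2 + m′)) (m≤m+n m n)
  edge-bounded (leaf j<n)   = z<s , +-monoʳ-< m j<n

  adjℕ : ℕ → ℕ → Bool
  adjℕ a b with a <ᵇ m | b <ᵇ m
  ... | true  | true  = cycAdj m a b
  ... | true  | false = a ≡ᵇ 0
  ... | false | true  = b ≡ᵇ 0
  ... | false | false = false

  squidAdj≡adjℕ : ∀ x y → squidAdj m n x y ≡ adjℕ (toℕ x) (toℕ y)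
  squidAdj≡adjℕ x y with toℕ x <ᵇ m | toℕ y <ᵇ m
  ... | true  | true  = refl
  ... | true  | false = refl
  ... | false | true  = refl
  ... | false | false = refl

  adjℕ-cycle : ∀ {a b} → a < m → b < m → adjℕ a b ≡ cycAdj m a b
  adjℕ-cycle {a} {b} a<m b<m with a <ᵇ m | <⇒<ᵇ a<m | b <ᵇ m | <⇒<ᵇ b<m
  ... | true | _ | true | _ = refl

  adjℕ-root-leaf : ∀ {a b} → a < m → m ≤ b → adjℕ a b ≡ (a ≡ᵇ 0)
  adjℕ-root-leaf {a} {b} a<m m≤b with a <ᵇ m | <⇒<ᵇ a<m | b <ᵇ m in b<ᵇm
  ... | true | _ | false = refl
  ... | true | _ | true  = contradiction (<ᵇ⇒< b m (subst T (sym b<ᵇm) _)) (≤⇒≯ m≤b)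

  adjℕ-leaf-root : ∀ {a b} → m ≤ a → b < m → adjℕ a b ≡ (b ≡ᵇ 0)
  adjℕ-leaf-root {a} {b} m≤a b<m with a <ᵇ m in a<ᵇm | b <ᵇ m | <⇒<ᵇ b<m
  ... | false | true | _ = refl
  ... | true  | true | _ = contradiction (<ᵇ⇒< a m (subst T (sym a<ᵇm) _)) (≤⇒≯ m≤a)

  adjℕ-leaves : ∀ {a b} → m ≤ a → m ≤ b → adjℕ a b ≡ false
  adjℕ-leaves {a} {b} m≤a m≤b with a <ᵇ m in a<ᵇm | b <ᵇ m in b<ᵇm
  ... | false | false = refl
  ... | true  | _     = contradiction (<ᵇ⇒< a m (subst T (sym a<ᵇm) _)) (≤⇒≯ m≤a)
  ... | false | true  = contradiction (<ᵇ⇒< b m (subst T (sym b<ᵇm) _)) (≤⇒≯ m≤b)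

  edge⇒adj : ∀ {a b} → Edge a b → T (adjℕ a b)
  edge⇒adj (path {i} i+1<m) = subst T (sym (adjℕ-cycle (<-trans (n<1+n i) i+1<m) i+1<m))
    (Equivalence.from (T-∨ {suc i ≡ᵇ suc i}) (inj₁ (≡⇒≡ᵇ i i refl)))
  edge⇒adj close      = subst T (sym (adjℕ-cycle z<s (n<1+n (2 + m′))))
    (Equivalence.from (T-∨ {m′ ≡ᵇ m′}) (inj₁ (≡⇒≡ᵇ m′ m′ refl)))
  edge⇒adj (leaf {j} _) = subst T (sym (adjℕ-root-leaf z<s (m≤m+n m j))) _

  successor-edge : ∀ {a b} → b < m → T (suc a ≡ᵇ b) → Edge a b
  successor-edge {a} {b} b<m a+1≡b with ≡ᵇ⇒≡ (suc a) b a+1≡b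
  ... | refl = path b<m

  close-edge : ∀ {a b} → T (a ≡ᵇ 0) → T (b ≡ᵇ 2 + m′) → Edge a b
  close-edge {a} {b} a≡0 b≡last with ≡ᵇ⇒≡ a 0 a≡0 | ≡ᵇ⇒≡ b (2 + m′) b≡last
  ... | refl | refl = close

  leaf-edge : ∀ {a b} → T (a ≡ᵇ 0) → m ≤ b → b < N → Edge a b
  leaf-edge {a} a≡0 m≤b b<N with ≡ᵇ⇒≡ a 0 a≡0
  ... | refl = subst (Edge 0) (m+[n∸m]≡n m≤b) (leaf (subst (_ <_) (m+n∸m≡n m n) (∸-monoˡ-< b<N m≤b)))

  adj⇒edge : ∀ {a b} → a < N → b < N → T (adjℕ a b) → Edge a b ⊎ Edge b a
  adj⇒edge {a} {b} a<N b<N adjacent with a <? m | b <? m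
  ... | yes a<m | yes b<m = cycle (subst T (adjℕ-cycle a<m b<m) adjacent)
    where
    cycle : T (cycAdj m a b) → Edge a b ⊎ Edge b a
    cycle adj with Equivalence.to (T-∨ {suc a ≡ᵇ b}) adj
    ... | inj₁ a+1≡b = inj₁ (successor-edge b<m a+1≡b)
    ... | inj₂ adj′ with Equivalence.to (T-∨ {suc b ≡ᵇ a}) adj′
    ...   | inj₁ b+1≡a = inj₂ (successor-edge a<m b+1≡a)
    ...   | inj₂ adj″ with Equivalence.to (T-∨ {(a ≡ᵇ 0) ∧ (b ≡ᵇ 2 + m′)}) adj″
    ...     | inj₁ a0∧b-last = inj₁ (uncurry close-edge (Equivalence.to (T-∧ {a ≡ᵇ 0}) a0∧b-last))
    ...     | inj₂ b0∧a-last = inj₂ (uncurry close-edge (Equivalence.to (T-∧ {b ≡ᵇ 0}) b0∧a-last))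
  ... | yes a<m | no b≮m = inj₁ (leaf-edge (subst T (adjℕ-root-leaf a<m (≮⇒≥ b≮m)) adjacent) (≮⇒≥ b≮m) b<N)
  ... | no a≮m  | yes b<m = inj₂ (leaf-edge (subst T (adjℕ-leaf-root (≮⇒≥ a≮m) b<m) adjacent) (≮⇒≥ a≮m) a<N)
  ... | no a≮m  | no b≮m  = contradiction (subst T (adjℕ-leaves (≮⇒≥ a≮m) (≮⇒≥ b≮m)) adjacent) id

  Colouring : Set
  Colouring = Fin N → Fin N

  -- Vertices and colours are read as numbers; i mod N is a junk index for i ≥ N.
  colour : Colouring → ℕ → ℕ
  colour κ i = toℕ (κ (i mod N))

  colour-toℕ : ∀ κ x → colour κ (toℕ x) ≡ toℕ (κ x)
  colour-toℕ κ x = cong (toℕ ∘ κ) (mod-toℕ x)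

  properPair : Colouring → Fin N → Fin N → Bool
  properPair κ x y = not (squidAdj m n x y) ∨ not (κ x =ᶠ κ y)

  proper⇒ : ∀ {κ} → T (isProper (Squid m n) κ) → ∀ {a b} → Edge a b → colour κ a ≢ colour κ b
  proper⇒ {κ} proper {a} {b} e same = contradiction (≡⇒≡ᵇ _ _ same) (T-not⇒¬T different)
    where
    x y : Fin N
    x = a mod N
    y = b mod N
    adjacent : T (squidAdj m n x y)
    adjacent = subst T (sym (trans (squidAdj≡adjℕ x y)
                                   (cong₂ adjℕ (toℕ-mod (proj₁ (edge-bounded e))) (toℕ-mod (proj₂ (edge-bounded e))))))
                 (edge⇒adj e)
    different : T (not (κ x =ᶠ κ y))
    different = T-⇒ (allB-allFin⁻ {p = properPair κ x}
                       (allB-allFin⁻ {p = λ x → allB (allFin N) (properPair κ x)} proper x) y)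
                    adjacent

  proper⇐ : ∀ {κ} → (∀ {a b} → Edge a b → colour κ a ≢ colour κ b) → T (isProper (Squid m n) κ)
  proper⇐ {κ} edges-proper = allB-allFin⁺ λ x → allB-allFin⁺ {p = properPair κ x} λ y → T-⇒⁺ λ adjacent →
    ¬T⇒T-not (λ same → [ (λ e → edges-proper e (colour≡ x y (≡ᵇ⇒≡ _ _ same)))
                    , (λ e → edges-proper e (colour≡ y x (sym (≡ᵇ⇒≡ _ _ same)))) ]′
                    (adj⇒edge (toℕ<n x) (toℕ<n y) (subst T (squidAdj≡adjℕ x y) adjacent)))
    where
    colour≡ : ∀ x y → toℕ (κ x) ≡ toℕ (κ y) → colour κ (toℕ x) ≡ colour κ (toℕ y)
    colour≡ x y eq = trans (colour-toℕ κ x) (trans eq (sym (colour-toℕ κ y)))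

  classSize : Colouring → ℕ → ℕ
  classSize κ c = countBelow (λ i → colour κ i ≡ᵇ c) N

  colContent⁻ : ∀ {κ w} → T (colContent (Squid m n) κ (w ∘ toℕ)) → ∀ {c} → c < N → classSize κ c ≡ w c
  colContent⁻ {κ} {w} content {c} c<N = subst (λ c → classSize κ c ≡ w c) (toℕ-mod c<N)
    (trans (sym (count-allFin (λ v → κ v =ᶠ (c mod N))))
           (≡ᵇ⇒≡ _ _ (allB-allFin⁻ {p = λ k → count (allFin N) (λ v → κ v =ᶠ k) ≡ᵇ w (toℕ k)}
                                   content (c mod N))))

  colContent⁺ : ∀ {κ w} → (∀ {c} → c < N → classSize κ c ≡ w c) → T (colContent (Squid m n) κ (w ∘ toℕ))
  colContent⁺ {κ} {w} sizes = allB-allFin⁺ {p = λ k → count (allFin N) (λ v → κ v =ᶠ k) ≡ᵇ w (toℕ k)} λ k →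
    ≡⇒≡ᵇ _ _ (trans (count-allFin (λ v → κ v =ᶠ k)) (sizes (toℕ<n k)))

  colouringWith⁻ : ∀ {κ w} → T (colouringWith (Squid m n) (w ∘ toℕ) κ) →
                   T (isProper (Squid m n) κ) × (∀ {c} → c < N → classSize κ c ≡ w c)
  colouringWith⁻ {κ} {w} valid = let proper , content = Equivalence.to (T-∧ {isProper (Squid m n) κ}) valid in
    proper , colContent⁻ {κ} {w} content

  root-class : ∀ {κ} → T (isProper (Squid m n) κ) → 2 * classSize κ (colour κ 0) ≤ m
  root-class {κ} proper = begin
    2 * classSize κ c₀     ≡⟨ cong (2 *_) class-split ⟩
    2 * suc (interior m′)  ≡⟨ *-suc 2 (interior m′) ⟩
    2 + 2 * interior m′    ≤⟨ +-monoʳ-≤ 2 (countBelow-sparse (λ i → P (2 + i)) m′ interior-sparse) ⟩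
    m                      ∎
    where
    open ≤-Reasoning
    c₀ : ℕ
    c₀ = colour κ 0
    P : ℕ → Bool
    P i = colour κ i ≡ᵇ c₀
    interior : ℕ → ℕ
    interior = countBelow (λ i → P (2 + i))
    not-root-coloured : ∀ {a} → Edge 0 a → P a ≡ false
    not-root-coloured e = ¬T⇒≡false λ same → proper⇒ {κ} proper e (sym (≡ᵇ⇒≡ _ _ same))
    interior-sparse : ∀ {i} → suc i < m′ → T (P (2 + i)) → ¬ T (P (3 + i))
    interior-sparse {i} i+1<m′ sameᵢ sameᵢ₊₁ = proper⇒ {κ} proper (path (s<s (s<s (s<s (<-trans (n<1+n i) i+1<m′)))))
      (trans (≡ᵇ⇒≡ _ _ sameᵢ) (sym (≡ᵇ⇒≡ _ _ sameᵢ₊₁)))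
    class-split : classSize κ c₀ ≡ suc (interior m′)
    class-split = begin-equality
      countBelow P (m + n)                                   ≡⟨ countBelow-+ P m n ⟩
      countBelow P m + countBelow (λ j → P (m + j)) n        ≡⟨ cong (countBelow P m +_) no-leaf ⟩
      countBelow P m + 0                                     ≡⟨ +-identityʳ _ ⟩
      fromBool (P 0) + (fromBool (P 1) + interior (suc m′))  ≡⟨ cong₂ (λ p₀ p₁ → fromBool p₀ + (fromBool p₁ + interior (suc m′)))
                                                                        root-coloured (not-root-coloured (path (s<s z<s))) ⟩
      suc (interior (suc m′))                                ≡⟨ cong suc (countBelow-suc (λ i → P (2 + i)) m′) ⟩
      suc (interior m′ + fromBool (P (2 + m′)))              ≡⟨ cong (λ p → suc (interior m′ + fromBool p)) (not-root-coloured close) ⟩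
      suc (interior m′ + 0)                                  ≡⟨ cong suc (+-identityʳ _) ⟩
      suc (interior m′)                                      ∎
      where
      no-leaf : countBelow (λ j → P (m + j)) n ≡ 0
      no-leaf = countBelow-none n λ j<n → subst T (not-root-coloured (leaf j<n))
      root-coloured : P 0 ≡ true
      root-coloured = Equivalence.to T-≡ (≡⇒≡ᵇ c₀ c₀ refl)

  class-nonempty : ∀ κ {v} → v < N → 0 < classSize κ (colour κ v)
  class-nonempty κ {v} v<N = countBelow-pos (λ i → colour κ i ≡ᵇ colour κ v) v<N (≡⇒≡ᵇ (colour κ v) _ refl)

  zero-coefficient : ∀ w → (∀ c → 0 < w c → m < 2 * w c) → chromCoeff (Squid m n) (w ∘ toℕ) ≡ 0
  zero-coefficient w large =
    n≤0⇒n≡0 (ChromaticBounds.chromCoeff-≤ (Squid m n) (w ∘ toℕ) {[]} λ {κ} valid → ⊥-elim (impossible {κ} valid))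
    where
    impossible : ∀ {κ} → T (colouringWith (Squid m n) (w ∘ toℕ) κ) → ⊥
    impossible {κ} valid = <⇒≱ (large (colour κ 0) (subst (0 <_) root-class-size (class-nonempty κ z<s)))
                               (subst (λ s → 2 * s ≤ m) root-class-size (root-class {κ} proper))
      where
      proper : T (isProper (Squid m n) κ)
      proper = proj₁ (colouringWith⁻ {κ} {w} valid)
      root-class-size : classSize κ (colour κ 0) ≡ w (colour κ 0)
      root-class-size = proj₂ (colouringWith⁻ {κ} {w} valid) (toℕ<n (κ (0 mod N)))

  colourFrom : (ℕ → ℕ) → Colouring
  colourFrom g x = g (toℕ x) mod N

  module _ {g : ℕ → ℕ} (g<N : ∀ i → g i < N) where

    colour-colourFrom : ∀ {i} → i < N → colour (colourFrom g) i ≡ g i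
    colour-colourFrom {i} i<N = trans (toℕ-mod (g<N _)) (cong g (toℕ-mod i<N))

    colourFrom-valid : ∀ {w} → (∀ {a b} → Edge a b → g a ≢ g b) →
                       (∀ {c} → c < N → countBelow (λ i → g i ≡ᵇ c) N ≡ w c) →
                       T (colouringWith (Squid m n) (w ∘ toℕ) (colourFrom g))
    colourFrom-valid {w} g-proper g-sizes = Equivalence.from (T-∧ {isProper (Squid m n) (colourFrom g)})
      (proper⇐ {colourFrom g} proper , colContent⁺ {colourFrom g} {w} sizes)
      where
      proper : ∀ {a b} → Edge a b → colour (colourFrom g) a ≢ colour (colourFrom g) b
      proper e = subst₂ _≢_ (sym (colour-colourFrom (proj₁ (edge-bounded e))))
                            (sym (colour-colourFrom (proj₂ (edge-bounded e)))) (g-proper e)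
      sizes : ∀ {c} → c < N → classSize (colourFrom g) c ≡ w c
      sizes {c} c<N = trans (countBelow-cong N λ i<N → cong (_≡ᵇ c) (colour-colourFrom i<N)) (g-sizes c<N)

    ≗colourFrom : ∀ {κ} → (∀ {i} → i < N → colour κ i ≡ g i) → ∀ x → κ x ≡ colourFrom g x
    ≗colourFrom {κ} same x =
      toℕ-injective (trans (sym (colour-toℕ κ x)) (trans (same (toℕ<n x)) (sym (toℕ-mod (g<N (toℕ x))))))

  colourFrom-injective : ∀ {g g′} → (∀ i → g i < N) → (∀ i → g′ i < N) →
                         (∀ x → colourFrom g x ≡ colourFrom g′ x) → ∀ {i} → i < N → g i ≡ g′ i
  colourFrom-injective g<N g′<N same {i} i<N =
    trans (sym (colour-colourFrom g<N i<N)) (trans (cong toℕ (same (i mod N))) (colour-colourFrom g′<N i<N))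

  2<N : 2 < N
  2<N = s≤s (s≤s (s≤s z≤n))

  append-proper : ∀ {cyc lv} → (∀ {i} → suc i < m → cyc i ≢ cyc (suc i)) → cyc 0 ≢ cyc (2 + m′) →
                  (∀ {j} → j < n → cyc 0 ≢ lv j) → ∀ {a b} → Edge a b → append m cyc lv a ≢ append m cyc lv b
  append-proper {cyc} {lv} path-proper _ _ (path {i} i+1<m)
    rewrite append-< {m} {cyc} {lv} (<-trans (n<1+n i) i+1<m) | append-< {m} {cyc} {lv} i+1<m = path-proper i+1<m
  append-proper {cyc} {lv} _ close-proper _ close
    rewrite append-< {m} {cyc} {lv} (n<1+n (2 + m′)) = close-proper
  append-proper {cyc} {lv} _ _ leaf-proper (leaf {j} j<n)
    rewrite append-+ m {cyc} {lv} j = leaf-proper j<n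

-- The three cases

parts : List ℕ → ℕ → ℕ
parts []       _       = 0
parts (a ∷ as) zero    = a
parts (a ∷ as) (suc i) = parts as i

module EvenCycle (k n : ℕ) (2≤n : 2 ≤ n) where

  K : ℕ
  K = 2 + k

  open SquidColourings (1 + double k) n

  α : ℕ → ℕ
  α = parts (n + K ∷ K ∷ [])

  shifted-zero : chromCoeff (Squid m n) (shift α ∘ toℕ) ≡ 0
  shifted-zero = zero-coefficient (shift α) large
    where
    large : ∀ c → 0 < shift α c → m < 2 * shift α c
    large zero       _ = <-trans (n<1+n m) (odd<2* (K<pred[n+K] K 2≤n))
    large (suc zero) _ = <-trans (n<1+n m) (odd<2* (n<1+n K))
    large (suc (suc c)) ()

  colouring : ℕ → ℕ
  colouring = append m (alternate 1 0) (λ _ → 0)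

  colouring-valid : T (colouringWith (Squid m n) (α ∘ toℕ) (colourFrom colouring))
  colouring-valid = colourFrom-valid colouring<N
    (append-proper (λ {i} _ → alternate-adjacent (λ ()) i)
                   (λ 1≡last → contradiction (trans 1≡last (alternate-double 0 1 k)) λ ())
                   (λ _ ()))
    sizes
    where
    colouring<N : ∀ i → colouring i < N
    colouring<N i = ≤-<-trans (append-≤ {m} (alternate-≤ (s≤s z≤n) z≤n) (λ _ → z≤n) i) (<-trans (n<1+n 1) 2<N)
    sizes : ∀ {c} → c < N → countBelow (λ i → colouring i ≡ᵇ c) N ≡ α c
    sizes {c} _ = begin
      countBelow (λ i → colouring i ≡ᵇ c) (m + n)
        ≡⟨ countBelow-append (_≡ᵇ c) m {alternate 1 0} {λ _ → 0} n ⟩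
      countBelow (λ i → alternate 1 0 i ≡ᵇ c) (double K) + countBelow (λ _ → 0 ≡ᵇ c) n
        ≡⟨ cong₂ _+_ (countBelow-alternate (_≡ᵇ c) 1 0 K) (countBelow-const (0 ≡ᵇ c) n) ⟩
      K * (fromBool (1 ≡ᵇ c) + fromBool (0 ≡ᵇ c)) + n * fromBool (0 ≡ᵇ c)
        ≡⟨ by-colour c ⟩
      α c ∎
      where
      open ≡-Reasoning
      by-colour : ∀ c → K * (fromBool (1 ≡ᵇ c) + fromBool (0 ≡ᵇ c)) + n * fromBool (0 ≡ᵇ c) ≡ α c
      by-colour zero          = trans (cong₂ _+_ (*-identityʳ K) (*-identityʳ n)) (+-comm K n)
      by-colour (suc zero)    = trans (cong₂ _+_ (*-identityʳ K) (*-zeroʳ n)) (+-identityʳ K)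
      by-colour (suc (suc c)) = cong₂ _+_ (*-zeroʳ K) (*-zeroʳ n)

  not-schurPositive : ¬ SchurPositive (Squid m n)
  not-schurPositive sp = <⇒≱ positive
    (≤-trans (schurPositive⇒chromCoeff-shift (squidAdj m n) sp α (m<n+m K (<-trans z<s 2≤n))) (≤-reflexive shifted-zero))
    where
    positive : 0 < chromCoeff (Squid m n) (α ∘ toℕ)
    positive = ChromaticBounds.chromCoeff-≥ (Squid m n) (α ∘ toℕ) {colourFrom colouring ∷ []}
                 ([] ∷ []) (colouring-valid ∷ [])

module OddCycleManyLeaves (k n′ : ℕ) (K+2≤n : 3 + k ≤ suc n′) where

  K n : ℕ
  K = suc k
  n = suc n′

  open SquidColourings (double k) n

  α : ℕ → ℕ
  α = parts (n ∷ K ∷ suc K ∷ [])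

  shifted-zero : chromCoeff (Squid m n) (shift α ∘ toℕ) ≡ 0
  shifted-zero = zero-coefficient (shift α) large
    where
    large : ∀ c → 0 < shift α c → m < 2 * shift α c
    large zero                _ = odd<2* (s≤s⁻¹ K+2≤n)
    large (suc zero)          _ = odd<2* (n<1+n K)
    large (suc (suc zero))    _ = odd<2* (n<1+n K)
    large (suc (suc (suc c))) ()

  cycle leaves : ℕ → ℕ
  cycle  = insertAt (double K) 0 (alternate 1 2)
  leaves = insertAt 0 2 (λ _ → 0)

  colouring : ℕ → ℕ
  colouring = append m cycle leaves

  colouring-valid : T (colouringWith (Squid m n) (α ∘ toℕ) (colourFrom colouring))
  colouring-valid = colourFrom-valid colouring<N
    (append-proper (insertAt-alternate-adjacent {double K} {0} {1} {2} ≤-refl (λ ()) (λ ()) (λ ()) ∘ s<s⁻¹)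
                   (λ 1≡last → contradiction (trans 1≡last (insertAt-at (double K) {0} {alternate 1 2})) λ ())
                   λ { {zero} _ () ; {suc j} _ () })
    sizes
    where
    colouring<N : ∀ i → colouring i < N
    colouring<N i = ≤-<-trans
      (append-≤ {m} (insertAt-≤ {double K} {0} {alternate 1 2} z≤n (alternate-≤ (s≤s z≤n) ≤-refl))
                    (insertAt-≤ {0} {2} {λ _ → 0} ≤-refl (λ _ → z≤n)) i)
      2<N
    sizes : ∀ {c} → c < N → countBelow (λ i → colouring i ≡ᵇ c) N ≡ α c
    sizes {c} _ = begin
      countBelow (λ i → colouring i ≡ᵇ c) (m + n)
        ≡⟨ countBelow-append (_≡ᵇ c) m {cycle} {leaves} n ⟩
      countBelow (λ i → cycle i ≡ᵇ c) (suc (double K)) + countBelow (λ j → leaves j ≡ᵇ c) (suc n′)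
        ≡⟨ cong₂ _+_ (countBelow-insertAt (_≡ᵇ c) {double K} {0} {alternate 1 2} ≤-refl)
                     (countBelow-insertAt (_≡ᵇ c) {0} {2} {λ _ → 0} {n′} z≤n) ⟩
      countBelow (λ i → alternate 1 2 i ≡ᵇ c) (double K) + fromBool (0 ≡ᵇ c)
        + (countBelow (λ _ → 0 ≡ᵇ c) n′ + fromBool (2 ≡ᵇ c))
        ≡⟨ cong₂ (λ x y → x + fromBool (0 ≡ᵇ c) + (y + fromBool (2 ≡ᵇ c)))
                 (countBelow-alternate (_≡ᵇ c) 1 2 K) (countBelow-const (0 ≡ᵇ c) n′) ⟩
      K * (fromBool (1 ≡ᵇ c) + fromBool (2 ≡ᵇ c)) + fromBool (0 ≡ᵇ c) + (n′ * fromBool (0 ≡ᵇ c) + fromBool (2 ≡ᵇ c))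
        ≡⟨ by-colour c ⟩
      α c ∎
      where
      open ≡-Reasoning
      by-colour : ∀ c → K * (fromBool (1 ≡ᵇ c) + fromBool (2 ≡ᵇ c)) + fromBool (0 ≡ᵇ c)
                        + (n′ * fromBool (0 ≡ᵇ c) + fromBool (2 ≡ᵇ c)) ≡ α c
      by-colour zero                = trans (cong₂ (λ x y → x + 1 + (y + 0)) (*-zeroʳ K) (*-identityʳ n′))
                                            (cong suc (+-identityʳ n′))
      by-colour (suc zero)          = trans (cong₂ (λ x y → x + 0 + (y + 0)) (*-identityʳ K) (*-zeroʳ n′))
                                            (trans (+-identityʳ (K + 0)) (+-identityʳ K))
      by-colour (suc (suc zero))    = trans (cong₂ (λ x y → x + 0 + (y + 1)) (*-identityʳ K) (*-zeroʳ n′))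
                                            (trans (cong (_+ 1) (+-identityʳ K)) (+-comm K 1))
      by-colour (suc (suc (suc c))) = cong₂ (λ x y → x + 0 + (y + 0)) (*-zeroʳ K) (*-zeroʳ n′)

  not-schurPositive : ¬ SchurPositive (Squid m n)
  not-schurPositive sp = <⇒≱ positive
    (≤-trans (schurPositive⇒chromCoeff-shift (squidAdj m n) sp α (<-trans (n<1+n K) K+2≤n)) (≤-reflexive shifted-zero))
    where
    positive : 0 < chromCoeff (Squid m n) (α ∘ toℕ)
    positive = ChromaticBounds.chromCoeff-≥ (Squid m n) (α ∘ toℕ) {colourFrom colouring ∷ []}
                 ([] ∷ []) (colouring-valid ∷ [])

module OddCycleFewLeaves (k n : ℕ) (2≤n : 2 ≤ n) (n≤K : n ≤ suc k) where

  K : ℕ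
  K = suc k

  open SquidColourings (double k) n

  α : ℕ → ℕ
  α = parts (n + K ∷ K ∷ 1 ∷ [])

  twoAt : ℕ → ℕ → ℕ
  twoAt t = append m (insertAt t 2 (alternate 1 0)) (λ _ → 0)

  twoAt<N : ∀ t i → twoAt t i < N
  twoAt<N t i =
    ≤-<-trans (append-≤ {m} (insertAt-≤ {t} {2} {alternate 1 0} ≤-refl (alternate-≤ (s≤s z≤n) z≤n)) (λ _ → z≤n) i) 2<N

  twoAt-root≢0 : ∀ t → insertAt t 2 (alternate 1 0) 0 ≢ 0
  twoAt-root≢0 zero    ()
  twoAt-root≢0 (suc t) ()

  twoAt-valid : ∀ {t} → t ≤ double K → T (colouringWith (Squid m n) (α ∘ toℕ) (colourFrom (twoAt t)))
  twoAt-valid {t} t≤2K = colourFrom-valid (twoAt<N t)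
    (append-proper (insertAt-alternate-adjacent {t} {2} {1} {0} t≤2K (λ ()) (λ ()) (λ ()) ∘ s<s⁻¹)
                   root≢last (λ _ → twoAt-root≢0 t))
    sizes
    where
    root≢last : insertAt t 2 (alternate 1 0) 0 ≢ insertAt t 2 (alternate 1 0) (double K)
    root≢last with m≤n⇒m<n∨m≡n t≤2K
    ... | inj₂ refl = λ 1≡2 → contradiction (trans 1≡2 (insertAt-at (double K) {2} {alternate 1 0})) λ ()
    ... | inj₁ t<2K = λ root≡last →
      twoAt-root≢0 t (trans root≡last (trans (insertAt-> {t} {2} {alternate 1 0} t<2K) (alternate-double 0 1 k)))
    sizes : ∀ {c} → c < N → countBelow (λ i → twoAt t i ≡ᵇ c) N ≡ α c
    sizes {c} _ = begin
      countBelow (λ i → twoAt t i ≡ᵇ c) (m + n)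
        ≡⟨ countBelow-append (_≡ᵇ c) m {insertAt t 2 (alternate 1 0)} {λ _ → 0} n ⟩
      countBelow (λ i → insertAt t 2 (alternate 1 0) i ≡ᵇ c) (suc (double K)) + countBelow (λ _ → 0 ≡ᵇ c) n
        ≡⟨ cong₂ _+_ (countBelow-insertAt (_≡ᵇ c) {t} {2} {alternate 1 0} t≤2K) (countBelow-const (0 ≡ᵇ c) n) ⟩
      countBelow (λ i → alternate 1 0 i ≡ᵇ c) (double K) + fromBool (2 ≡ᵇ c) + n * fromBool (0 ≡ᵇ c)
        ≡⟨ cong (λ x → x + fromBool (2 ≡ᵇ c) + n * fromBool (0 ≡ᵇ c)) (countBelow-alternate (_≡ᵇ c) 1 0 K) ⟩
      K * (fromBool (1 ≡ᵇ c) + fromBool (0 ≡ᵇ c)) + fromBool (2 ≡ᵇ c) + n * fromBool (0 ≡ᵇ c)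
        ≡⟨ by-colour c ⟩
      α c ∎
      where
      open ≡-Reasoning
      by-colour : ∀ c → K * (fromBool (1 ≡ᵇ c) + fromBool (0 ≡ᵇ c)) + fromBool (2 ≡ᵇ c) + n * fromBool (0 ≡ᵇ c) ≡ α c
      by-colour zero                = trans (cong₂ (λ x y → x + 0 + y) (*-identityʳ K) (*-identityʳ n))
                                            (trans (cong (_+ n) (+-identityʳ K)) (+-comm K n))
      by-colour (suc zero)          = trans (cong₂ (λ x y → x + 0 + y) (*-identityʳ K) (*-zeroʳ n))
                                            (trans (+-identityʳ (K + 0)) (+-identityʳ K))
      by-colour (suc (suc zero))    = cong₂ (λ x y → x + 1 + y) (*-zeroʳ K) (*-zeroʳ n)
      by-colour (suc (suc (suc c))) = cong₂ (λ x y → x + 0 + y) (*-zeroʳ K) (*-zeroʳ n)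

  twoAt-distinct : ∀ {t t′} → t < t′ → t′ < suc (double K) →
                   ¬ (∀ x → colourFrom (twoAt t) x ≡ colourFrom (twoAt t′) x)
  twoAt-distinct {t} {t′} t<t′ t′≤2K same = <⇒≱ (s≤s (s≤s z≤n)) (subst (_≤ 1) (sym 2≡alt) (alternate-≤ ≤-refl z≤n t))
    where
    t<m : t < m
    t<m = <-trans t<t′ t′≤2K
    2≡alt : 2 ≡ alternate 1 0 t
    2≡alt = begin
      2                                         ≡⟨ insertAt-at t ⟨
      insertAt t 2 (alternate 1 0) t            ≡⟨ append-< {m} t<m ⟨
      twoAt t t                                ≡⟨ colourFrom-injective (twoAt<N t) (twoAt<N t′) same (<-≤-trans t<m (m≤m+n m n)) ⟩
      twoAt t′ t                               ≡⟨ append-< {m} t<m ⟩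
      insertAt t′ 2 (alternate 1 0) t           ≡⟨ insertAt-< t<t′ ⟩
      alternate 1 0 t                           ∎
      where open ≡-Reasoning

  lower-bound : suc (double K) ≤ chromCoeff (Squid m n) (α ∘ toℕ)
  lower-bound = subst (_≤ chromCoeff (Squid m n) (α ∘ toℕ)) (length-applyUpTo (colourFrom ∘ twoAt) (suc (double K)))
    (ChromaticBounds.chromCoeff-≥ (Squid m n) (α ∘ toℕ)
      (UniqueSₚ.applyUpTo⁺₁ (VecEq.≋-setoid (setoid (Fin N)) N) (colourFrom ∘ twoAt) (suc (double K)) twoAt-distinct)
      (Allₚ.applyUpTo⁺₁ (colourFrom ∘ twoAt) (suc (double K)) (twoAt-valid ∘ s≤s⁻¹)))

  large-unless-2 : ∀ c → c ≢ 2 → 0 < shift α c → m < 2 * shift α c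
  large-unless-2 zero                _   _ = odd<2* (K<pred[n+K] K 2≤n)
  large-unless-2 (suc zero)          _   _ = odd<2* (n<1+n K)
  large-unless-2 (suc (suc zero))    c≢2 _ = contradiction refl c≢2
  large-unless-2 (suc (suc (suc c))) _   ()

  shifted-support : ∀ c → 0 < shift α c → c ≤ 2
  shifted-support zero                _ = z≤n
  shifted-support (suc zero)          _ = s≤s z≤n
  shifted-support (suc (suc zero))    _ = ≤-refl
  shifted-support (suc (suc (suc c))) ()

  shiftedColouring : ℕ → ℕ → ℕ → ℕ
  shiftedColouring p ℓ = append m (insertAt 0 2 (alternate p (1 ∸ p))) (insertAt ℓ 1 (λ _ → 0))

  shiftedColouring<N : ∀ {p} → p ≤ 1 → ∀ ℓ i → shiftedColouring p ℓ i < N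
  shiftedColouring<N {p} p≤1 ℓ i = ≤-<-trans
    (append-≤ {m} (insertAt-≤ {0} {2} {alternate p (1 ∸ p)} ≤-refl
                               (alternate-≤ (≤-trans p≤1 (n≤1+n 1)) (≤-trans (m∸n≤m 1 p) (n≤1+n 1))))
                  (insertAt-≤ {ℓ} {1} {λ _ → 0} (n≤1+n 1) (λ _ → z≤n)) i)
    2<N

  module ShiftedContent {κ : Colouring} (valid : T (colouringWith (Squid m n) (shift α ∘ toℕ) κ)) where

    proper : T (isProper (Squid m n) κ)
    proper = proj₁ (colouringWith⁻ {κ} {shift α} valid)

    sizes : ∀ {c} → c < N → classSize κ c ≡ shift α c
    sizes = proj₂ (colouringWith⁻ {κ} {shift α} valid)

    used : ∀ {v} → v < N → 0 < shift α (colour κ v)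
    used {v} v<N = subst (0 <_) (sizes (toℕ<n (κ (v mod N)))) (class-nonempty κ v<N)

    root-colour : colour κ 0 ≡ 2
    root-colour with colour κ 0 ≟ 2
    ... | yes c₀≡2 = c₀≡2
    ... | no  c₀≢2 = contradiction (large-unless-2 (colour κ 0) c₀≢2 (used z<s))
                       (≤⇒≯ (subst (λ s → 2 * s ≤ m) (sizes (toℕ<n (κ (0 mod N)))) (root-class {κ} proper)))

    only-root-2 : ∀ {v} → v < N → colour κ v ≡ 2 → v ≡ 0
    only-root-2 {v} v<N v↦2 with countBelow≡1⇒ (λ i → colour κ i ≡ᵇ 2) N (sizes 2<N)
    ... | i , _ , _ , unique = trans (unique v<N (≡⇒≡ᵇ _ _ v↦2)) (sym (unique z<s (≡⇒≡ᵇ _ _ root-colour)))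

    binary : ∀ {v} → v < N → v ≢ 0 → colour κ v ≤ 1
    binary {v} v<N v≢0 with m≤n⇒m<n∨m≡n (shifted-support (colour κ v) (used v<N))
    ... | inj₁ c<2  = s≤s⁻¹ c<2
    ... | inj₂ c≡2  = contradiction (only-root-2 v<N c≡2) v≢0

    p : ℕ
    p = colour κ 1

    p≤1 : p ≤ 1
    p≤1 = binary (s≤s (s≤s z≤n)) λ ()

    cycle-alternates : ∀ {i} → i < double K → colour κ (suc i) ≡ alternate p (1 ∸ p) i
    cycle-alternates = binary-path-alternates (colour κ ∘ suc)
      (λ i<2K → binary (<-≤-trans (s≤s i<2K) (m≤m+n m n)) λ ())
      (λ {i} i+1<2K → proper⇒ {κ} proper (path (s≤s i+1<2K)))

    cycle-ones : countBelow (λ i → colour κ i ≡ᵇ 1) m ≡ K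
    cycle-ones = begin
      fromBool (colour κ 0 ≡ᵇ 1) + countBelow (λ i → colour κ (suc i) ≡ᵇ 1) (double K)
        ≡⟨ cong₂ _+_ (cong (λ c → fromBool (c ≡ᵇ 1)) root-colour)
                     (countBelow-cong (double K) (cong (_≡ᵇ 1) ∘ cycle-alternates)) ⟩
      countBelow (λ i → alternate p (1 ∸ p) i ≡ᵇ 1) (double K)
        ≡⟨ countBelow-alternate (_≡ᵇ 1) p (1 ∸ p) K ⟩
      K * (fromBool (p ≡ᵇ 1) + fromBool (1 ∸ p ≡ᵇ 1))
        ≡⟨ cong (K *_) (one-of p≤1) ⟩
      K * 1
        ≡⟨ *-identityʳ K ⟩
      K ∎
      where
      open ≡-Reasoning
      one-of : ∀ {p} → p ≤ 1 → fromBool (p ≡ᵇ 1) + fromBool (1 ∸ p ≡ᵇ 1) ≡ 1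
      one-of {zero}     _ = refl
      one-of {suc zero} _ = refl
      one-of {suc (suc _)} (s≤s ())

    leaf-ones : countBelow (λ j → colour κ (m + j) ≡ᵇ 1) n ≡ 1
    leaf-ones = +-cancelˡ-≡ K _ _ (begin
      K + countBelow (λ j → colour κ (m + j) ≡ᵇ 1) n
        ≡⟨ cong (_+ countBelow (λ j → colour κ (m + j) ≡ᵇ 1) n) cycle-ones ⟨
      countBelow (λ i → colour κ i ≡ᵇ 1) m + countBelow (λ j → colour κ (m + j) ≡ᵇ 1) n
        ≡⟨ countBelow-+ (λ i → colour κ i ≡ᵇ 1) m n ⟨
      classSize κ 1
        ≡⟨ sizes (s≤s (s≤s z≤n)) ⟩
      suc K
        ≡⟨ +-comm 1 K ⟩
      K + 1 ∎)
      where open ≡-Reasoning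

    MarkedLeaf : ℕ → Set
    MarkedLeaf ℓ = T (colour κ (m + ℓ) ≡ᵇ 1) × (∀ {j} → j < n → T (colour κ (m + j) ≡ᵇ 1) → j ≡ ℓ)

    marked-leaf : ∃[ ℓ ] (ℓ < n × MarkedLeaf ℓ)
    marked-leaf = countBelow≡1⇒ (λ j → colour κ (m + j) ≡ᵇ 1) n leaf-ones

    matches : ∀ {ℓ} → MarkedLeaf ℓ → ∀ {i} → i < N → colour κ i ≡ shiftedColouring p ℓ i
    matches {ℓ} (ℓ↦1 , unique) {i} i<N with i <? m
    ... | yes i<m = trans (on-cycle i<m) (sym (append-< {m} i<m))
      where
      on-cycle : ∀ {i} → i < m → colour κ i ≡ insertAt 0 2 (alternate p (1 ∸ p)) i
      on-cycle {zero}  _          = root-colour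
      on-cycle {suc i} (s<s i<2K) = cycle-alternates i<2K
    ... | no  i≮m = begin
      colour κ i                    ≡⟨ cong (colour κ) i≡m+j ⟩
      colour κ (m + j)              ≡⟨ on-leaf ⟩
      insertAt ℓ 1 (λ _ → 0) j      ≡⟨ append-+ m {insertAt 0 2 (alternate p (1 ∸ p))} j ⟨
      shiftedColouring p ℓ (m + j)  ≡⟨ cong (shiftedColouring p ℓ) i≡m+j ⟨
      shiftedColouring p ℓ i        ∎
      where
      open ≡-Reasoning
      j : ℕ
      j = i ∸ m
      i≡m+j : i ≡ m + j
      i≡m+j = sym (m+[n∸m]≡n (≮⇒≥ i≮m))
      j<n : j < n
      j<n = +-cancelˡ-< m j n (subst (_< m + n) i≡m+j i<N)
      on-leaf : colour κ (m + j) ≡ insertAt ℓ 1 (λ _ → 0) j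
      on-leaf with j ≟ ℓ | ≤1⇒≡0⊎≡1 (binary (+-monoʳ-< m j<n) (λ ()))
      ... | yes refl | _        = trans (≡ᵇ⇒≡ _ 1 ℓ↦1) (sym (insertAt-at ℓ))
      ... | no  j≢ℓ  | inj₁ j↦0 = trans j↦0 (sym (insertAt-const j≢ℓ))
      ... | no  j≢ℓ  | inj₂ j↦1 = contradiction (unique j<n (≡⇒≡ᵇ _ 1 j↦1)) j≢ℓ

    ≗shiftedColouring : ∀ {q ℓ} → p ≡ q → MarkedLeaf ℓ → ∀ x → κ x ≡ colourFrom (shiftedColouring q ℓ) x
    ≗shiftedColouring {ℓ = ℓ} refl marked = ≗colourFrom (shiftedColouring<N p≤1 ℓ) (matches marked)

  candidates : List Colouring
  candidates = applyUpTo (colourFrom ∘ shiftedColouring 0) n ++ applyUpTo (colourFrom ∘ shiftedColouring 1) n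

  upper-bound : chromCoeff (Squid m n) (shift α ∘ toℕ) ≤ n + n
  upper-bound = subst (chromCoeff (Squid m n) (shift α ∘ toℕ) ≤_)
    (trans (length-++ (applyUpTo (colourFrom ∘ shiftedColouring 0) n))
           (cong₂ _+_ (length-applyUpTo _ n) (length-applyUpTo _ n)))
    (ChromaticBounds.chromCoeff-≤ (Squid m n) (shift α ∘ toℕ) covered)
    where
    covered : ∀ {κ} → T (colouringWith (Squid m n) (shift α ∘ toℕ) κ) → _∈ᵛ_ (setoid (Fin N)) κ candidates
    covered {κ} valid with ShiftedContent.marked-leaf {κ} valid | ≤1⇒≡0⊎≡1 (ShiftedContent.p≤1 {κ} valid)
    ... | ℓ , ℓ<n , marked | inj₁ p≡0 = Anyₚ.++⁺ˡ
      (Anyₚ.applyUpTo⁺ (colourFrom ∘ shiftedColouring 0) (ShiftedContent.≗shiftedColouring {κ} valid p≡0 marked) ℓ<n)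
    ... | ℓ , ℓ<n , marked | inj₂ p≡1 = Anyₚ.++⁺ʳ (applyUpTo (colourFrom ∘ shiftedColouring 0) n)
      (Anyₚ.applyUpTo⁺ (colourFrom ∘ shiftedColouring 1) (ShiftedContent.≗shiftedColouring {κ} valid p≡1 marked) ℓ<n)

  not-schurPositive : ¬ SchurPositive (Squid m n)
  not-schurPositive sp = <⇒≱ (s≤s (double-mono-≤ n≤K)) (begin
    suc (double K)                          ≤⟨ lower-bound ⟩
    chromCoeff (Squid m n) (α ∘ toℕ)        ≤⟨ schurPositive⇒chromCoeff-shift (squidAdj m n) sp α (m<n+m K (<-trans z<s 2≤n)) ⟩
    chromCoeff (Squid m n) (shift α ∘ toℕ)  ≤⟨ upper-bound ⟩
    n + n                                   ≡⟨ double≡+ n ⟨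
    double n                                ∎)
    where open ≤-Reasoning

odd≡2*suc∸1 : ∀ K → suc (double K) ≡ 2 * suc K ∸ 1
odd≡2*suc∸1 K = trans (cong suc (double≡+ K)) (trans (sym (+-suc K K)) (cong (K +_) (sym (+-identityʳ (suc K)))))

theorem3p8 : (m n : ℕ) → 3 ≤ m → 2 ≤ n → m ≢ 2 * n ∸ 1 → ¬ SchurPositive (Squid m n)
theorem3p8 m n 3≤m 2≤n m≢2n∸1 with even-or-odd m
... | zero        , inj₁ refl = contradiction 3≤m λ ()
... | suc zero    , inj₁ refl = contradiction 3≤m λ { (s≤s (s≤s ())) }
... | suc (suc k) , inj₁ refl = EvenCycle.not-schurPositive k n 2≤n
... | zero        , inj₂ refl = contradiction 3≤m λ { (s≤s ()) }
... | suc k       , inj₂ refl with <-cmp n (suc (suc k))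
...   | tri< n<K+1 _ _ = OddCycleFewLeaves.not-schurPositive k n 2≤n (s≤s⁻¹ n<K+1)
...   | tri≈ _ n≡K+1 _ = contradiction (trans (odd≡2*suc∸1 (suc k)) (cong (λ x → 2 * x ∸ 1) (sym n≡K+1))) m≢2n∸1
...   | tri> _ _ K+1<n@(s≤s _) = OddCycleManyLeaves.not-schurPositive k _ K+1<n
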